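{- Let $G$ be a connected graph of order $n\geqslant 3$ with maximum degree $\Delta(G)$, and let $k\geqslant 2$ be an integer. Then $$D(G^{\frac{1}{k}})\leqslant \min\Big\{s : 2^k+\sum_{j=3}^{s} j^{k-1}\geqslant \Delta(G)\Big\}.$$
   Context: Graphs are finite and simple. The $k$-subdivision $G^{\frac{1}{k}}$ is obtained by replacing each edge $uv$ of $G$ by a path of length $k$ between $u$ and $v$ with $k-1$ new internal vertices. The distinguishing number $D(H)$ is the least $d$ such that some labeling $V(H)\to\{1,\dots,d\}$ is preserved by no non-trivial automorphism of $H$. The sum $\sum_{j=3}^{s}$ is empty (equal to $0$) when $s<3$. -}

module Defs where

open import Data.Nat using (ℕ; zero; suc; _+_; _∸_; _^_; _≤_; _⊔_)
open import Data.Fin using (Fin; toℕ) renaming (_<_ to _<ᶠ_)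
open import Data.Bool using (Bool; true; false)
open import Data.List using (List; length; filterᵇ; map; foldr; allFin; upTo; drop)
open import Data.Nat.ListAction using (sum)
open import Data.Sum using (_⊎_; inj₁; inj₂)
open import Data.Product using (Σ; _×_; _,_; ∃)
open import Relation.Binary.PropositionalEquality using (_≡_)
open import Function.Bundles using (_↔_; Inverse; _⇔_)

record SimpleGraph (n : ℕ) : Set where
  field
    adj    : Fin n → Fin n → Bool
    sym    : ∀ u v → adj u v ≡ adj v u
    irrefl : ∀ u → adj u u ≡ false
open SimpleGraph public

data Reach {n : ℕ} (G : SimpleGraph n) : Fin n → Fin n → Set where
  here : ∀ {u} → Reach G u u
  step : ∀ {u v w} → adj G u v ≡ true → Reach G v w → Reach G u w

Connected : {n : ℕ} → SimpleGraph n → Set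
Connected G = ∀ u v → Reach G u v

degree : {n : ℕ} → SimpleGraph n → Fin n → ℕ
degree {n} G v = length (filterᵇ (adj G v) (allFin n))

maxDegree : {n : ℕ} → SimpleGraph n → ℕ
maxDegree {n} G = foldr _⊔_ 0 (map (degree G) (allFin n))

-- k-subdivision G^{1/k} (for k ≥ 1)

record Edge {n : ℕ} (G : SimpleGraph n) : Set where
  constructor edge
  field
    src : Fin n
    tgt : Fin n
    lt  : src <ᶠ tgt
    isE : adj G src tgt ≡ true
open Edge public

SubV : {n : ℕ} → SimpleGraph n → ℕ → Set
SubV {n} G k = Fin n ⊎ (Edge G × Fin (k ∸ 1))

-- the path of length k replacing edge e = uv is
--   u — (e,0) — (e,1) — … — (e,k-2) — v
data Step {n : ℕ} (G : SimpleGraph n) (k : ℕ) (e : Edge G) : SubV G k → SubV G k → Set where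
  direct : k ∸ 1 ≡ 0 → Step G k e (inj₁ (src e)) (inj₁ (tgt e))
  first  : (i : Fin (k ∸ 1)) → toℕ i ≡ 0 → Step G k e (inj₁ (src e)) (inj₂ (e , i))
  middle : (i j : Fin (k ∸ 1)) → toℕ j ≡ suc (toℕ i) → Step G k e (inj₂ (e , i)) (inj₂ (e , j))
  final  : (i : Fin (k ∸ 1)) → suc (toℕ i) ≡ k ∸ 1 → Step G k e (inj₂ (e , i)) (inj₁ (tgt e))

SubAdj : {n : ℕ} (G : SimpleGraph n) (k : ℕ) → SubV G k → SubV G k → Set
SubAdj G k x y = Σ (Edge G) λ e → Step G k e x y ⊎ Step G k e y x

IsAutomorphism : {V : Set} → (V → V → Set) → V ↔ V → Set
IsAutomorphism {V} _∼_ σ = ∀ (x y : V) → (x ∼ y) ⇔ (Inverse.to σ x ∼ Inverse.to σ y)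

IsDistinguishing : {V : Set} → (V → V → Set) → (d : ℕ) → (V → Fin d) → Set
IsDistinguishing {V} _∼_ d c =
  ∀ (σ : V ↔ V) → IsAutomorphism _∼_ σ →
  (∀ x → c (Inverse.to σ x) ≡ c x) → ∀ x → Inverse.to σ x ≡ x

-- D(H) ≤ s  :⇔  some d ≤ s admits a distinguishing d-labeling
DistNumberAtMost : {V : Set} → (V → V → Set) → ℕ → Set
DistNumberAtMost {V} _∼_ s = Σ ℕ λ d → d ≤ s × Σ (V → Fin d) λ c → IsDistinguishing _∼_ d c

-- Σ_{j=3}^{s} j^{k-1}  (empty when s < 3)
powSum : ℕ → ℕ → ℕ
powSum k s = sum (map (λ j → j ^ (k ∸ 1)) (drop 3 (upTo (suc s))))

BoundCond : ℕ → ℕ → ℕ → Set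
BoundCond k Δ s = Δ ≤ 2 ^ k + powSum k s

IsMinBound : ℕ → ℕ → ℕ → Set
IsMinBound k Δ s = 2 ≤ s × BoundCond k Δ s × (∀ t → 2 ≤ t → BoundCond k Δ t → s ≤ t)

-- Colour G^{1/k} along a breadth-first spanning tree rooted at a vertex r of degree at least
-- min(Δ, 3). The path replacing the tree edge from p down to v carries a word of k colours ending
-- with the colour of v, the code of v. Distinct children of p get distinct codes, which needs
-- Δ ≤ s^k words; this follows from the minimality of s, as 2^k + Σ_{j=3}^{s} j^(k-1) ≤ s^k. Paths
-- of non-tree edges get a single colour. An automorphism preserving the colouring and fixing r
-- fixes everything, by induction down the tree: the path from a fixed p down to a child v is mapped
-- to a path from p with the same colours, that is to a sibling with the same code, that is to v
-- itself. Finally r is pinned down by a special leg at r: for Δ ≥ 3, r is the only vertex of its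
-- colour with a leg coloured c₀ throughout (a transposition of the codes keeps this pattern away
-- from every other vertex); for Δ ≤ 2, the graph is a path or a cycle, and three marked vertices
-- next to r suffice.

module Submission where

open import Defs renaming (sym to adj-sym; step to reach-step)
open import Axiom.UniquenessOfIdentityProofs.WithK using (uip)
open import Data.Bool using (Bool; true; false; not; _∧_; _∨_; if_then_else_; T; T?)
open import Data.Bool.ListAction using (any)
open import Data.Bool.Properties using (T-≡; T-∨; T-∧)
open import Data.Empty using (⊥; ⊥-elim)
open import Data.Fin using (Fin; toℕ; fromℕ<; combine; finToFun; funToFin) renaming (zero to fz; suc to fs)
open import Data.Fin.Permutation.Components using (transpose; transpose-inverse)
open import Data.Fin.Properties using (toℕ-injective; toℕ<n; fromℕ<-toℕ; toℕ-fromℕ<; fromℕ<-injective; injective⇒≤; nonZeroIndex; funToFin-finToFin; finToFun-funToFin) renaming (_≟_ to _≟ᶠ_)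
open import Data.List using (List; []; _∷_; length; filterᵇ; map; foldr; allFin; lookup; applyUpTo)
open import Data.List.Extrema.Nat using (argmin; argmin-sel; f[argmin]≤f[xs])
open import Data.List.Membership.Propositional using (_∈_; lose)
open import Data.List.Membership.Propositional.Properties using (∈-allFin; ∈-filter⁺; ∈-filter⁻; ∈-lookup)
open import Data.List.Properties using (filter-notAll)
open import Data.List.Relation.Unary.All as All using (All; []; _∷_)
open import Data.List.Relation.Unary.Any as Any using (here; there)
open import Data.List.Relation.Unary.Any.Properties using (any⁺; any⁻)
open import Data.List.Relation.Unary.AllPairs using ([]; _∷_)
open import Data.List.Relation.Unary.Unique.Propositional using (Unique)
open import Data.List.Relation.Unary.Unique.Propositional.Properties using (filter⁺; allFin⁺; Unique[x∷xs]⇒x∉xs)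
open import Data.Nat using (ℕ; zero; suc; _+_; _*_; _∸_; _^_; _≤_; _<_; _⊔_; z≤n; s≤s; s≤s⁻¹; _≤?_; _<?_; _<ᵇ_; NonZero)
open import Data.Nat.DivMod using (_%_; _mod_; m<n⇒m%n≡m; m%n<n; [m+kn]%n≡m%n)
open import Data.Nat.Induction using (<-rec)
open import Data.Nat.ListAction using (sum)
open import Data.Nat.Properties
open import Data.Product using (Σ; _×_; _,_; proj₁; proj₂)
open import Data.Sum as Sum using (_⊎_; inj₁; inj₂)
open import Data.Sum.Properties using (inj₁-injective)
open import Data.Unit using (tt)
open import Function using (id; _∘_; Injective)
open import Function.Bundles using (_↔_; Inverse; Equivalence)
open import Relation.Binary.Definitions using (tri<; tri≈; tri>)
open import Relation.Binary.PropositionalEquality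
open import Relation.Nullary using (¬_; Dec; yes; no; contradiction; ¬?)
open import Relation.Nullary.Decidable using (⌊_⌋; toWitness; fromWitness; dec-true; decidable-stable; toSum; _×-dec_)

module _ {A : Set} (f g : A → Bool) (f⇒g : ∀ x → f x ≡ true → g x ≡ true) where

  length-filterᵇ-mono : ∀ xs → length (filterᵇ f xs) ≤ length (filterᵇ g xs)
  length-filterᵇ-mono [] = z≤n
  length-filterᵇ-mono (x ∷ xs) with f x in fx | g x in gx
  ... | true  | true  = s≤s (length-filterᵇ-mono xs)
  ... | true  | false with () ← trans (sym (f⇒g x fx)) gx
  ... | false | true  = m≤n⇒m≤1+n (length-filterᵇ-mono xs)
  ... | false | false = length-filterᵇ-mono xs

  length-filterᵇ-< : ∀ {w} xs → w ∈ xs → f w ≡ false → g w ≡ true →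
                     length (filterᵇ f xs) < length (filterᵇ g xs)
  length-filterᵇ-< (x ∷ xs) (here refl) fw gw rewrite fw | gw = s≤s (length-filterᵇ-mono xs)
  length-filterᵇ-< (x ∷ xs) (there w∈xs) fw gw with f x in fx | g x in gx
  ... | true  | true  = s≤s (length-filterᵇ-< xs w∈xs fw gw)
  ... | true  | false with () ← trans (sym (f⇒g x fx)) gx
  ... | false | true  = m≤n⇒m≤1+n (length-filterᵇ-< xs w∈xs fw gw)
  ... | false | false = length-filterᵇ-< xs w∈xs fw gw

module _ {A : Set} (f : A → Bool) {x : A} where

  ∈-filterᵇ⁺ : ∀ {xs} → x ∈ xs → f x ≡ true → x ∈ filterᵇ f xs
  ∈-filterᵇ⁺ x∈xs fx = ∈-filter⁺ (T? ∘ f) x∈xs (Equivalence.from T-≡ fx)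

  ∈-filterᵇ⁻ : ∀ xs → x ∈ filterᵇ f xs → f x ≡ true
  ∈-filterᵇ⁻ xs x∈ = Equivalence.to T-≡ (proj₂ (∈-filter⁻ (T? ∘ f) {xs = xs} x∈))

module _ {A : Set} (f : A → ℕ) where

  ≤-foldr-⊔ : ∀ {x} xs → x ∈ xs → f x ≤ foldr _⊔_ 0 (map f xs)
  ≤-foldr-⊔ (y ∷ xs) (here refl) = m≤m⊔n (f y) _
  ≤-foldr-⊔ (y ∷ xs) (there x∈xs) = ≤-trans (≤-foldr-⊔ xs x∈xs) (m≤n⊔m (f y) _)

  <-foldr-⊔⁻ : ∀ {t} xs → t < foldr _⊔_ 0 (map f xs) → Σ A λ x → t < f x
  <-foldr-⊔⁻ (y ∷ xs) t< with f y ≤? foldr _⊔_ 0 (map f xs)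
  ... | yes fy≤ = <-foldr-⊔⁻ xs (subst (_ <_) (m≤n⇒m⊔n≡n fy≤) t<)
  ... | no fy≰ = y , subst (_ <_) (m≥n⇒m⊔n≡m (<⇒≤ (≰⇒> fy≰))) t<

lookup-injective : {A : Set} {xs : List A} → Unique xs → Injective _≡_ _≡_ (lookup xs)
lookup-injective {xs = x ∷ xs} u {fz} {fz} _ = refl
lookup-injective {xs = x ∷ xs} u {fz} {fs j} eq = contradiction (subst (_∈ xs) (sym eq) (∈-lookup j)) (Unique[x∷xs]⇒x∉xs u)
lookup-injective {xs = x ∷ xs} u {fs i} {fz} eq = contradiction (subst (_∈ xs) eq (∈-lookup i)) (Unique[x∷xs]⇒x∉xs u)
lookup-injective {xs = x ∷ xs} (_ ∷ u) {fs i} {fs j} eq = cong fs (lookup-injective u eq)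

applyUpTo-cong : ∀ {A : Set} {f g : ℕ → A} → (∀ i → f i ≡ g i) → ∀ t → applyUpTo f t ≡ applyUpTo g t
applyUpTo-cong f≗g zero = refl
applyUpTo-cong f≗g (suc t) = cong₂ _∷_ (f≗g 0) (applyUpTo-cong (f≗g ∘ suc) t)

least : (ℕ → Bool) → ℕ → ℕ
least f zero = zero
least f (suc b) = if f zero then zero else suc (least (f ∘ suc) b)

least-satisfies : ∀ (f : ℕ → Bool) b {t} → t ≤ b → T (f t) → T (f (least f b))
least-satisfies f zero z≤n ft = ft
least-satisfies f (suc b) {t} t≤b ft with f zero in f0
... | true = subst T (sym f0) tt
least-satisfies f (suc b) {zero} t≤b ft | false = ⊥-elim (subst T f0 ft)
least-satisfies f (suc b) {suc t} t≤b ft | false = least-satisfies (f ∘ suc) b (s≤s⁻¹ t≤b) ft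

least-minimal : ∀ (f : ℕ → Bool) b {t} → t < least f b → ¬ T (f t)
least-minimal f (suc b) {t} t<least with f zero in f0
least-minimal f (suc b) {zero} t<least | false = subst T f0
least-minimal f (suc b) {suc t} t<least | false = least-minimal (f ∘ suc) b (s≤s⁻¹ t<least)

transpose-injective : ∀ {t} (i j : Fin t) {x y} → transpose i j x ≡ transpose i j y → x ≡ y
transpose-injective i j {x} {y} eq =
  trans (sym (transpose-inverse j i)) (trans (cong (transpose j i) eq) (transpose-inverse j i))

transpose-matchˡ : ∀ {t} (i j : Fin t) → transpose i j i ≡ j
transpose-matchˡ i j rewrite dec-true (i ≟ᶠ i) refl = refl

transpose≡ʳ⇒≡ˡ : ∀ {t} (i j : Fin t) {x} → transpose i j x ≡ j → x ≡ i
transpose≡ʳ⇒≡ˡ i j eq = transpose-injective i j (trans eq (sym (transpose-matchˡ i j)))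

funToFin-cong : ∀ {a b} {f g : Fin a → Fin b} → (∀ i → f i ≡ g i) → funToFin f ≡ funToFin g
funToFin-cong {zero} _ = refl
funToFin-cong {suc a} f≗g = cong₂ combine (f≗g fz) (funToFin-cong (f≗g ∘ fs))

finToFun-injective : ∀ {a b} {x y : Fin (b ^ a)} → (∀ i → finToFun {b} {a} x i ≡ finToFun y i) → x ≡ y
finToFun-injective {a} {b} {x} {y} eq =
  trans (sym (funToFin-finToFin {a} {b} x)) (trans (funToFin-cong eq) (funToFin-finToFin {a} {b} y))

mod-injective : ∀ {a b t} .{{_ : NonZero t}} → a < t → b < t → a mod t ≡ b mod t → a ≡ b
mod-injective {a} {b} {t} a<t b<t eq = begin
  a              ≡⟨ m<n⇒m%n≡m a<t ⟨
  a % t          ≡⟨ toℕ-fromℕ< _ ⟨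
  toℕ (a mod t)  ≡⟨ cong toℕ eq ⟩
  toℕ (b mod t)  ≡⟨ toℕ-fromℕ< _ ⟩
  b % t          ≡⟨ m<n⇒m%n≡m b<t ⟩
  b              ∎
  where open ≡-Reasoning

module Degrees {n : ℕ} (G : SimpleGraph n) where

  neighbours : Fin n → List (Fin n)
  neighbours p = filterᵇ (adj G p) (allFin n)

  rank : Fin n → Fin n → ℕ
  rank p v = length (filterᵇ (λ u → toℕ u <ᵇ toℕ v) (neighbours p))

  ∈-neighbours : ∀ {p v} → adj G p v ≡ true → v ∈ neighbours p
  ∈-neighbours {p} {v} a = ∈-filterᵇ⁺ (adj G p) (∈-allFin v) a

  ∈-neighbours⁻ : ∀ {p v} → v ∈ neighbours p → adj G p v ≡ true
  ∈-neighbours⁻ {p} = ∈-filterᵇ⁻ (adj G p) (allFin n)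

  private
    <ᵇ-irrefl : ∀ m → (m <ᵇ m) ≡ false
    <ᵇ-irrefl zero = refl
    <ᵇ-irrefl (suc m) = <ᵇ-irrefl m

    <ᵇ-true : ∀ {m o} → m < o → (m <ᵇ o) ≡ true
    <ᵇ-true m<o = Equivalence.to T-≡ (<⇒<ᵇ m<o)

    <ᵇ-true⁻ : ∀ {m o} → (m <ᵇ o) ≡ true → m < o
    <ᵇ-true⁻ eq = <ᵇ⇒< _ _ (Equivalence.from T-≡ eq)

  rank<degree : ∀ {p v} → adj G p v ≡ true → rank p v < degree G p
  rank<degree {p} {v} a =
    filter-notAll (T? ∘ λ u → toℕ u <ᵇ toℕ v) (neighbours p) (lose (∈-neighbours a) (<-irrefl refl ∘ <ᵇ⇒< (toℕ v) (toℕ v)))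

  rank-<-mono : ∀ {p v w} → adj G p v ≡ true → toℕ v < toℕ w → rank p v < rank p w
  rank-<-mono {p} {v} {w} a v<w = length-filterᵇ-< _ _ (λ u u<v → <ᵇ-true (<-trans (<ᵇ-true⁻ u<v) v<w))
    (neighbours p) (∈-neighbours a) (<ᵇ-irrefl (toℕ v)) (<ᵇ-true v<w)

  rank-injective : ∀ {p v w} → adj G p v ≡ true → adj G p w ≡ true → rank p v ≡ rank p w → v ≡ w
  rank-injective {p} {v} {w} av aw eq with <-cmp (toℕ v) (toℕ w)
  ... | tri< v<w _ _ = contradiction eq (<⇒≢ (rank-<-mono av v<w))
  ... | tri≈ _ v≡w _ = toℕ-injective v≡w
  ... | tri> _ _ w<v = contradiction (sym eq) (<⇒≢ (rank-<-mono aw w<v))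

  unique-neighbours⇒≤degree : ∀ {p xs} → Unique xs → All (λ u → adj G p u ≡ true) xs → length xs ≤ degree G p
  unique-neighbours⇒≤degree {p} {xs} u adjacent =
    injective⇒≤ {f = λ i → fromℕ< (rank<degree (adjacent-at i))}
      λ {i} {j} eq → lookup-injective u (rank-injective (adjacent-at i) (adjacent-at j) (fromℕ<-injective _ _ _ _ eq))
    where
    adjacent-at : ∀ i → adj G p (lookup xs i) ≡ true
    adjacent-at i = All.lookup adjacent (∈-lookup i)

  degree≤maxDegree : ∀ p → degree G p ≤ maxDegree G
  degree≤maxDegree p = ≤-foldr-⊔ (degree G) (allFin n) (∈-allFin p)

  <maxDegree⇒<degree : ∀ {t} → t < maxDegree G → Σ (Fin n) λ p → t < degree G p
  <maxDegree⇒<degree = <-foldr-⊔⁻ (degree G) (allFin n)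

  neighbours-unique : ∀ p → Unique (neighbours p)
  neighbours-unique p = filter⁺ _ (allFin⁺ n)

  two-neighbours : ∀ {p} → 2 ≤ degree G p →
                   Σ (Fin n) λ x → Σ (Fin n) λ y → adj G p x ≡ true × adj G p y ≡ true × x ≢ y
  two-neighbours {p} 2≤d with neighbours p in eq | neighbours-unique p | 2≤d
  ... | [] | _ | ()
  ... | _ ∷ [] | _ | s≤s ()
  ... | x ∷ y ∷ _ | (x≢y ∷ _) ∷ _ | _ = x , y , adj-of (here refl) , adj-of (there (here refl)) , x≢y
    where
    adj-of : ∀ {u} → u ∈ _ → adj G p u ≡ true
    adj-of u∈ = ∈-neighbours⁻ (subst (_ ∈_) (sym eq) u∈)

  three-neighbours : ∀ {p} → 3 ≤ degree G p →
                     Σ (Fin n) λ x → Σ (Fin n) λ y → Σ (Fin n) λ z →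
                     adj G p x ≡ true × adj G p y ≡ true × adj G p z ≡ true × x ≢ y × x ≢ z × y ≢ z
  three-neighbours {p} 3≤d with neighbours p in eq | neighbours-unique p | 3≤d
  ... | [] | _ | ()
  ... | _ ∷ [] | _ | s≤s ()
  ... | _ ∷ _ ∷ [] | _ | s≤s (s≤s ())
  ... | x ∷ y ∷ z ∷ _ | (x≢y ∷ x≢z ∷ _) ∷ (y≢z ∷ _) ∷ _ | _ =
    x , y , z , adj-of (here refl) , adj-of (there (here refl)) , adj-of (there (there (here refl))) , x≢y , x≢z , y≢z
    where
    adj-of : ∀ {u} → u ∈ _ → adj G p u ≡ true
    adj-of u∈ = ∈-neighbours⁻ (subst (_ ∈_) (sym eq) u∈)

  two-neighbours⇒2≤degree : ∀ {p x y} → adj G p x ≡ true → adj G p y ≡ true → x ≢ y → 2 ≤ degree G p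
  two-neighbours⇒2≤degree ax ay x≢y = unique-neighbours⇒≤degree ((x≢y ∷ []) ∷ [] ∷ []) (ax ∷ ay ∷ [])

  reach⇒adjacent : maxDegree G ≤ 1 → ∀ {u w} → Reach G u w → w ≡ u ⊎ adj G u w ≡ true
  reach⇒adjacent Δ≤1 here = inj₁ refl
  reach⇒adjacent Δ≤1 (reach-step {u} {v} {w} u~v rest) with reach⇒adjacent Δ≤1 rest
  ... | inj₁ refl = inj₂ u~v
  ... | inj₂ v~w with w ≟ᶠ u
  ...   | yes w≡u = inj₁ w≡u
  ...   | no w≢u = ⊥-elim (1+n≰n (≤-trans (two-neighbours⇒2≤degree v~w (trans (adj-sym G v u) u~v) w≢u)
                                           (≤-trans (degree≤maxDegree v) Δ≤1)))

connected⇒2≤maxDegree : ∀ {n} (G : SimpleGraph (suc (suc (suc n)))) → Connected G → 2 ≤ maxDegree G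
connected⇒2≤maxDegree G connected = ≮⇒≥ (two-steps ∘ s≤s⁻¹)
  where
  open Degrees G
  two-steps : maxDegree G ≤ 1 → ⊥
  two-steps Δ≤1 with reach⇒adjacent Δ≤1 (connected fz (fs fz)) | reach⇒adjacent Δ≤1 (connected fz (fs (fs fz)))
  ... | inj₂ a₁ | inj₂ a₂ = 1+n≰n (≤-trans (two-neighbours⇒2≤degree a₁ a₂ λ ()) (≤-trans (degree≤maxDegree fz) Δ≤1))

module Subdivision {n : ℕ} (G : SimpleGraph n) (m : ℕ) where

  k : ℕ
  k = suc (suc m)

  V : Set
  V = SubV G k

  _~_ : V → V → Set
  _~_ = SubAdj G k

  ~-sym : ∀ {x y} → x ~ y → y ~ x
  ~-sym (e , s) = e , Sum.swap s

  src≢tgt : (e : Edge G) → src e ≢ tgt e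
  src≢tgt e eq = <⇒≢ (lt e) (cong toℕ eq)

  edge-ext : ∀ {e e' : Edge G} → src e ≡ src e' → tgt e ≡ tgt e' → e ≡ e'
  edge-ext {edge s t l a} {edge .s .t l' a'} refl refl rewrite <-irrelevant l l' | uip a a' = refl

  -- positions beyond k are junk, sent to tgt e
  pathVertex : Edge G → ℕ → V
  pathVertex e zero = inj₁ (src e)
  pathVertex e (suc j) with j <? suc m
  ... | yes j<k-1 = inj₂ (e , fromℕ< j<k-1)
  ... | no _ = inj₁ (tgt e)

  pathVertex-internal : ∀ e (i : Fin (suc m)) → pathVertex e (suc (toℕ i)) ≡ inj₂ (e , i)
  pathVertex-internal e i with toℕ i <? suc m
  ... | yes i<k-1 = cong (λ i' → inj₂ (e , i')) (fromℕ<-toℕ i i<k-1)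
  ... | no i≮k-1 = contradiction (toℕ<n i) i≮k-1

  pathVertex-end : ∀ e → pathVertex e k ≡ inj₁ (tgt e)
  pathVertex-end e with suc m <? suc m
  ... | yes m<m = contradiction m<m (<-irrefl refl)
  ... | no _ = refl

  position : Edge G → V → ℕ
  position e (inj₁ v) with v ≟ᶠ src e
  ... | yes _ = 0
  ... | no _ = k
  position e (inj₂ (_ , i)) = suc (toℕ i)

  position-pathVertex : ∀ e j → j ≤ k → position e (pathVertex e j) ≡ j
  position-pathVertex e zero _ with src e ≟ᶠ src e
  ... | yes _ = refl
  ... | no ne = contradiction refl ne
  position-pathVertex e (suc j) j<k with j <? suc m
  ... | yes j<k-1 = cong suc (toℕ-fromℕ< j<k-1)
  ... | no j≮k-1 with tgt e ≟ᶠ src e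
  ...   | yes t≡s = contradiction (sym t≡s) (src≢tgt e)
  ...   | no _ = cong suc (≤-antisym (≮⇒≥ j≮k-1) (s≤s⁻¹ j<k))

  pathVertex-injective : ∀ e {j j'} → j ≤ k → j' ≤ k → pathVertex e j ≡ pathVertex e j' → j ≡ j'
  pathVertex-injective e {j} {j'} j≤k j'≤k eq = begin
    j                            ≡⟨ position-pathVertex e j j≤k ⟨
    position e (pathVertex e j)  ≡⟨ cong (position e) eq ⟩
    position e (pathVertex e j') ≡⟨ position-pathVertex e j' j'≤k ⟩
    j'                           ∎
    where open ≡-Reasoning

  interiorIndex : ∀ {j} → 0 < j → j < k → Σ (Fin (suc m)) λ i → suc (toℕ i) ≡ j
  interiorIndex {suc j} _ j<k = fromℕ< (s≤s⁻¹ j<k) , cong suc (toℕ-fromℕ< (s≤s⁻¹ j<k))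

  internal-successor : ∀ e (i : Fin (suc m)) → inj₂ (e , i) ~ pathVertex e (suc (suc (toℕ i)))
  internal-successor e i with toℕ i <? m
  ... | yes i<m = subst (inj₂ (e , i) ~_) next (e , inj₁ (middle i (fromℕ< (s≤s i<m)) (toℕ-fromℕ< (s≤s i<m))))
    where
    next : inj₂ (e , fromℕ< (s≤s i<m)) ≡ pathVertex e (suc (suc (toℕ i)))
    next = trans (sym (pathVertex-internal e _)) (cong (λ j → pathVertex e (suc j)) (toℕ-fromℕ< (s≤s i<m)))
  ... | no i≮m = subst (inj₂ (e , i) ~_) (sym last) (e , inj₁ (final i (cong suc i≡m)))
    where
    i≡m : toℕ i ≡ m
    i≡m = ≤-antisym (s≤s⁻¹ (toℕ<n i)) (≮⇒≥ i≮m)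
    last : pathVertex e (suc (suc (toℕ i))) ≡ inj₁ (tgt e)
    last = trans (cong (λ j → pathVertex e (suc (suc j))) i≡m) (pathVertex-end e)

  pathVertex-adjacent : ∀ e {j} → j < k → pathVertex e j ~ pathVertex e (suc j)
  pathVertex-adjacent e {zero} _ rewrite pathVertex-internal e fz = e , inj₁ (first fz refl)
  pathVertex-adjacent e {suc j} j<k with interiorIndex {suc j} (s≤s z≤n) j<k
  ... | i , refl rewrite pathVertex-internal e i = internal-successor e i

  internal-neighbours : ∀ {e i y} → inj₂ (e , i) ~ y →
                        y ≡ pathVertex e (toℕ i) ⊎ y ≡ pathVertex e (suc (suc (toℕ i)))
  internal-neighbours {e} (.e , inj₁ (middle _ j j≡1+i)) =
    inj₂ (trans (sym (pathVertex-internal e j)) (cong (λ t → pathVertex e (suc t)) j≡1+i))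
  internal-neighbours {e} (.e , inj₁ (final _ 1+i≡k-1)) =
    inj₂ (trans (sym (pathVertex-end e)) (cong (λ t → pathVertex e (suc t)) (sym 1+i≡k-1)))
  internal-neighbours {e} (.e , inj₂ (first _ i≡0)) = inj₁ (cong (pathVertex e) (sym i≡0))
  internal-neighbours {e} (.e , inj₂ (middle i' _ 1+i'≡i)) =
    inj₁ (trans (sym (pathVertex-internal e i')) (cong (pathVertex e) (sym 1+i'≡i)))

  Leg : Set
  Leg = Edge G × Bool

  start end : Leg → Fin n
  start (e , false) = src e
  start (e , true) = tgt e
  end (e , false) = tgt e
  end (e , true) = src e

  reverse : Leg → Leg
  reverse (e , b) = e , not b

  orient : Bool → ℕ → ℕ
  orient false j = j
  orient true j = k ∸ j

  legVertex : Leg → ℕ → V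
  legVertex (e , b) j = pathVertex e (orient b j)

  legVertex-start : ∀ ℓ → legVertex ℓ 0 ≡ inj₁ (start ℓ)
  legVertex-start (e , false) = refl
  legVertex-start (e , true) = pathVertex-end e

  legVertex-end : ∀ ℓ → legVertex ℓ k ≡ inj₁ (end ℓ)
  legVertex-end (e , false) = pathVertex-end e
  legVertex-end (e , true) rewrite n∸n≡0 k = refl

  legVertex-reverse : ∀ ℓ {j} → j ≤ k → legVertex ℓ j ≡ legVertex (reverse ℓ) (k ∸ j)
  legVertex-reverse (e , false) j≤k = cong (pathVertex e) (sym (m∸[m∸n]≡n j≤k))
  legVertex-reverse (e , true) _ = refl

  orient≤k : ∀ b {j} → j ≤ k → orient b j ≤ k
  orient≤k false j≤k = j≤k
  orient≤k true {j} _ = m∸n≤m k j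

  orient-injective : ∀ b {j j'} → j ≤ k → j' ≤ k → orient b j ≡ orient b j' → j ≡ j'
  orient-injective false _ _ eq = eq
  orient-injective true j≤k j'≤k eq = ∸-cancelˡ-≡ j≤k j'≤k eq

  orient-interior : ∀ b {j} → 0 < j → j < k → 0 < orient b j × orient b j < k
  orient-interior false 0<j j<k = 0<j , j<k
  orient-interior true 0<j j<k = m<n⇒0<n∸m j<k , ∸-monoʳ-< 0<j (<⇒≤ j<k)

  legVertex-injective : ∀ ℓ {j j'} → j ≤ k → j' ≤ k → legVertex ℓ j ≡ legVertex ℓ j' → j ≡ j'
  legVertex-injective (e , b) j≤k j'≤k eq =
    orient-injective b j≤k j'≤k (pathVertex-injective e (orient≤k b j≤k) (orient≤k b j'≤k) eq)

  legVertex-interior : ∀ ℓ {j} → 0 < j → j < k →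
                       Σ (Fin (suc m)) λ i → suc (toℕ i) ≡ orient (proj₂ ℓ) j × legVertex ℓ j ≡ inj₂ (proj₁ ℓ , i)
  legVertex-interior (e , b) 0<j j<k with orient-interior b 0<j j<k
  ... | 0<j' , j'<k with interiorIndex 0<j' j'<k
  ...   | i , 1+i≡j' = i , 1+i≡j' , trans (cong (pathVertex e) (sym 1+i≡j')) (pathVertex-internal e i)

  legVertex-adjacent : ∀ ℓ {j} → j < k → legVertex ℓ j ~ legVertex ℓ (suc j)
  legVertex-adjacent (e , false) j<k = pathVertex-adjacent e j<k
  legVertex-adjacent (e , true) {j} j<k rewrite +-∸-assoc 1 j<k =
    ~-sym (pathVertex-adjacent e (s≤s (m∸n≤m (suc m) j)))

  legVertex-neighbours : ∀ ℓ {j y} → 0 < j → j < k → legVertex ℓ j ~ y →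
                         y ≡ legVertex ℓ (j ∸ 1) ⊎ y ≡ legVertex ℓ (suc j)
  legVertex-neighbours (e , b) {suc j} {y} 0<j j<k a with legVertex-interior (e , b) 0<j j<k
  ... | i , 1+i≡j' , eq = reorient b 1+i≡j' (internal-neighbours (subst (_~ y) eq a))
    where
    reorient : ∀ b → suc (toℕ i) ≡ orient b (suc j) →
               y ≡ pathVertex e (toℕ i) ⊎ y ≡ pathVertex e (suc (suc (toℕ i))) →
               y ≡ legVertex (e , b) j ⊎ y ≡ legVertex (e , b) (suc (suc j))
    reorient false refl = id
    reorient true 1+i≡j' = Sum.swap ∘ Sum.map (λ y≡ → trans y≡ (cong (pathVertex e) before))
                                              (λ y≡ → trans y≡ (cong (pathVertex e) after))
      where
      before : toℕ i ≡ k ∸ suc (suc j)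
      before = trans (cong (_∸ 1) 1+i≡j') (pred[m∸n]≡m∸[1+n] k (suc j))
      after : suc (suc (toℕ i)) ≡ k ∸ j
      after = trans (cong suc 1+i≡j') (sym (+-∸-assoc 1 (<-trans (n<1+n j) j<k)))

  start-neighbours : ∀ {p y} → inj₁ p ~ y → Σ Leg λ ℓ → start ℓ ≡ p × y ≡ legVertex ℓ 1
  start-neighbours (e , inj₁ (direct ()))
  start-neighbours (e , inj₂ (direct ()))
  start-neighbours (e , inj₁ (first fz refl)) = (e , false) , refl , sym (pathVertex-internal e fz)
  start-neighbours (e , inj₂ (final i 1+i≡k-1)) =
    (e , true) , refl , trans (sym (pathVertex-internal e i)) (cong (pathVertex e) 1+i≡k-1)

  leg-adjacent : ∀ ℓ → adj G (start ℓ) (end ℓ) ≡ true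
  leg-adjacent (e , false) = isE e
  leg-adjacent (e , true) = trans (adj-sym G (tgt e) (src e)) (isE e)

  leg-unique : ∀ {ℓ ℓ'} → start ℓ ≡ start ℓ' → end ℓ ≡ end ℓ' → ℓ ≡ ℓ'
  leg-unique {e , false} {e' , false} s≡ e≡ = cong (_, false) (edge-ext s≡ e≡)
  leg-unique {e , true} {e' , true} s≡ e≡ = cong (_, true) (edge-ext e≡ s≡)
  leg-unique {e , false} {e' , true} s≡ e≡ =
    contradiction (lt e') (<-asym (subst₂ (λ a b → toℕ a < toℕ b) s≡ e≡ (lt e)))
  leg-unique {e , true} {e' , false} s≡ e≡ =
    contradiction (lt e) (<-asym (subst₂ (λ a b → toℕ a < toℕ b) (sym s≡) (sym e≡) (lt e')))

  start-injective : ∀ e {b b'} → start (e , b) ≡ start (e , b') → b ≡ b'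
  start-injective e {false} {false} _ = refl
  start-injective e {true} {true} _ = refl
  start-injective e {false} {true} eq = contradiction eq (src≢tgt e)
  start-injective e {true} {false} eq = contradiction (sym eq) (src≢tgt e)

  adj-irrefl : ∀ {p w} → adj G p w ≡ true → p ≢ w
  adj-irrefl {p} a refl with () ← trans (sym a) (irrefl G p)

  legFor : ∀ {p w} → adj G p w ≡ true → Σ Leg λ ℓ → start ℓ ≡ p × end ℓ ≡ w
  legFor {p} {w} a with <-cmp (toℕ p) (toℕ w)
  ... | tri< p<w _ _ = (edge p w p<w a , false) , refl , refl
  ... | tri≈ _ p≡w _ = contradiction (toℕ-injective p≡w) (adj-irrefl a)
  ... | tri> _ _ w<p = (edge w p w<p (trans (adj-sym G w p) a) , true) , refl , refl

  data LegPosition (ℓ : Leg) (j : ℕ) : Set where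
    atEnd    : j ≡ k → legVertex ℓ j ≡ inj₁ (end ℓ) → LegPosition ℓ j
    interior : j < k → (i : Fin (suc m)) → legVertex ℓ j ≡ inj₂ (proj₁ ℓ , i) → LegPosition ℓ j

  legPosition : ∀ ℓ {j} → 0 < j → j ≤ k → LegPosition ℓ j
  legPosition ℓ {j} 0<j j≤k with <-cmp j k
  ... | tri< j<k _ _ = let i , _ , eq = legVertex-interior ℓ 0<j j<k in interior j<k i eq
  ... | tri≈ _ refl _ = atEnd refl (legVertex-end ℓ)
  ... | tri> _ _ j>k = contradiction j≤k (<⇒≱ j>k)

  legVertex-cross-injective : ∀ {ℓ ℓ' j j'} → start ℓ ≡ start ℓ' → 0 < j → j ≤ k → 0 < j' → j' ≤ k →
                              legVertex ℓ j ≡ legVertex ℓ' j' → ℓ ≡ ℓ' × j ≡ j'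
  legVertex-cross-injective {e , b} {e' , b'} s≡ 0<j j≤k 0<j' j'≤k eq
    with legPosition (e , b) 0<j j≤k | legPosition (e' , b') 0<j' j'≤k
  ... | atEnd refl x | atEnd refl y = leg-unique s≡ (inj₁-injective (trans (sym x) (trans eq y))) , refl
  ... | atEnd _ x | interior _ _ y with () ← trans (sym x) (trans eq y)
  ... | interior _ _ x | atEnd _ y with () ← trans (sym x) (trans eq y)
  ... | interior _ i x | interior _ i' y with trans (sym x) (trans eq y)
  ...   | refl with start-injective e {b} {b'} s≡
  ...     | refl = refl , legVertex-injective (e , b) j≤k j'≤k eq

  originals-nonadjacent : ∀ {p q} → ¬ (inj₁ p ~ inj₁ q)
  originals-nonadjacent a with start-neighbours a
  ... | ℓ , _ , y≡ with legPosition ℓ {1} (s≤s z≤n) (s≤s z≤n)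
  ...   | atEnd () _
  ...   | interior _ _ x with () ← trans y≡ x

  ~-irrefl : ∀ {x} → ¬ (x ~ x)
  ~-irrefl {inj₁ p} = originals-nonadjacent
  ~-irrefl {inj₂ (e , i)} a = Sum.[ below , above ]′ (internal-neighbours a)
    where
    at : pathVertex e (suc (toℕ i)) ≡ inj₂ (e , i)
    at = pathVertex-internal e i
    i+2≤k : suc (suc (toℕ i)) ≤ k
    i+2≤k = s≤s (toℕ<n i)
    below : ¬ inj₂ (e , i) ≡ pathVertex e (toℕ i)
    below eq = 1+n≢n (pathVertex-injective e (<⇒≤ i+2≤k) (≤-trans (n≤1+n _) (<⇒≤ i+2≤k)) (trans at eq))
    above : ¬ inj₂ (e , i) ≡ pathVertex e (suc (suc (toℕ i)))
    above eq = 1+n≢n (sym (pathVertex-injective e (<⇒≤ i+2≤k) i+2≤k (trans at eq)))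

  three-neighbours⇒original : ∀ {x y₁ y₂ y₃} → x ~ y₁ → x ~ y₂ → x ~ y₃ → y₁ ≢ y₂ → y₁ ≢ y₃ → y₂ ≢ y₃ →
                              Σ (Fin n) λ p → x ≡ inj₁ p
  three-neighbours⇒original {inj₁ p} _ _ _ _ _ _ = p , refl
  three-neighbours⇒original {inj₂ _} a₁ a₂ a₃ y₁≢y₂ y₁≢y₃ y₂≢y₃
    with internal-neighbours a₁ | internal-neighbours a₂ | internal-neighbours a₃
  ... | inj₁ p | inj₁ q | _     = contradiction (trans p (sym q)) y₁≢y₂
  ... | inj₂ p | inj₂ q | _     = contradiction (trans p (sym q)) y₁≢y₂
  ... | inj₁ p | inj₂ _ | inj₁ q = contradiction (trans p (sym q)) y₁≢y₃
  ... | inj₁ _ | inj₂ p | inj₂ q = contradiction (trans p (sym q)) y₂≢y₃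
  ... | inj₂ p | inj₁ _ | inj₂ q = contradiction (trans p (sym q)) y₁≢y₃
  ... | inj₂ _ | inj₁ p | inj₁ q = contradiction (trans p (sym q)) y₂≢y₃

  start-adjacent : ∀ ℓ → inj₁ (start ℓ) ~ legVertex ℓ 1
  start-adjacent ℓ = subst (_~ legVertex ℓ 1) (legVertex-start ℓ) (legVertex-adjacent ℓ (s≤s z≤n))

  module Automorphism (σ : V ↔ V) (aut : IsAutomorphism _~_ σ) where
    open Inverse σ public using (to; from)

    to-from : ∀ y → to (from y) ≡ y
    to-from = Inverse.strictlyInverseˡ σ

    from-to : ∀ x → from (to x) ≡ x
    from-to = Inverse.strictlyInverseʳ σ

    to-injective : ∀ {x y} → to x ≡ to y → x ≡ y
    to-injective {x} {y} eq = trans (sym (from-to x)) (trans (cong from eq) (from-to y))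

    ~-to : ∀ {x y} → x ~ y → to x ~ to y
    ~-to {x} {y} = Equivalence.to (aut x y)

    ~-from : ∀ {x y} → x ~ y → from x ~ from y
    ~-from {x} {y} a = Equivalence.from (aut (from x) (from y)) (subst₂ _~_ (sym (to-from x)) (sym (to-from y)) a)

    -- inner vertices of a leg have only two neighbours, so σ follows a leg once its first step is known
    map-leg : ∀ ℓ {q} → to (inj₁ (start ℓ)) ≡ inj₁ q →
              Σ Leg λ ℓ' → start ℓ' ≡ q × (∀ {j} → j ≤ k → to (legVertex ℓ j) ≡ legVertex ℓ' j)
    map-leg ℓ {q} t-start with start-neighbours (subst (_~ to (legVertex ℓ 1)) t-start (~-to (start-adjacent ℓ)))
    ... | ℓ' , start≡q , t₁ = ℓ' , start≡q , along
      where
      t₀ : to (legVertex ℓ 0) ≡ legVertex ℓ' 0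
      t₀ = trans (cong to (legVertex-start ℓ)) (trans t-start (trans (cong inj₁ (sym start≡q)) (sym (legVertex-start ℓ'))))

      consecutive : ∀ j → suc j ≤ k →
                    to (legVertex ℓ j) ≡ legVertex ℓ' j × to (legVertex ℓ (suc j)) ≡ legVertex ℓ' (suc j)
      consecutive zero _ = t₀ , t₁
      consecutive (suc j) j+2≤k with consecutive j (<⇒≤ j+2≤k)
      ... | tⱼ , tⱼ₊₁ with legVertex-neighbours ℓ' (s≤s z≤n) j+2≤k
                             (subst (_~ to (legVertex ℓ (suc (suc j)))) tⱼ₊₁ (~-to (legVertex-adjacent ℓ j+2≤k)))
      ...   | inj₂ tⱼ₊₂ = tⱼ₊₁ , tⱼ₊₂
      ...   | inj₁ back = contradiction
                (legVertex-injective ℓ j+2≤k (≤-trans (n≤1+n j) (<⇒≤ j+2≤k)) (to-injective (trans back (sym tⱼ))))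
                (≢-sym (<⇒≢ (<-trans (n<1+n j) (n<1+n (suc j)))))

      along : ∀ {j} → j ≤ k → to (legVertex ℓ j) ≡ legVertex ℓ' j
      along {zero} _ = t₀
      along {suc j} j+1≤k = proj₂ (consecutive j j+1≤k)

    branch-image-original : ∀ {p y₁ y₂ y₃} → adj G p y₁ ≡ true → adj G p y₂ ≡ true → adj G p y₃ ≡ true →
                            y₁ ≢ y₂ → y₁ ≢ y₃ → y₂ ≢ y₃ → Σ (Fin n) λ q → to (inj₁ p) ≡ inj₁ q
    branch-image-original {p} a₁ a₂ a₃ y₁≢y₂ y₁≢y₃ y₂≢y₃ =
      three-neighbours⇒original (~-to (first-step a₁)) (~-to (first-step a₂)) (~-to (first-step a₃))
        (distinct a₁ a₂ y₁≢y₂) (distinct a₁ a₃ y₁≢y₃) (distinct a₂ a₃ y₂≢y₃)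
      where
      first-step : ∀ {y} (a : adj G p y ≡ true) → inj₁ p ~ legVertex (proj₁ (legFor a)) 1
      first-step a with legFor a
      ... | ℓ , s≡p , _ = subst (λ x → inj₁ x ~ legVertex ℓ 1) s≡p (start-adjacent ℓ)
      distinct : ∀ {y y'} (a : adj G p y ≡ true) (a' : adj G p y' ≡ true) → y ≢ y' →
                 to (legVertex (proj₁ (legFor a)) 1) ≢ to (legVertex (proj₁ (legFor a')) 1)
      distinct a a' y≢y' eq with legFor a | legFor a'
      ... | ℓ , s≡p , e≡y | ℓ' , s'≡p , e'≡y' = y≢y' (trans (sym e≡y) (trans (cong end same-leg) e'≡y'))
        where
        same-leg : ℓ ≡ ℓ'
        same-leg = proj₁ (legVertex-cross-injective {ℓ} {ℓ'} (trans s≡p (sym s'≡p))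
                     (s≤s z≤n) (s≤s z≤n) (s≤s z≤n) (s≤s z≤n) (to-injective eq))

record RootedTree {n : ℕ} (G : SimpleGraph n) : Set where
  field
    root               : Fin n
    parent             : Fin n → Fin n
    key                : Fin n → ℕ
    key-injective      : ∀ {v w} → key v ≡ key w → v ≡ w
    key-root<          : ∀ {v} → v ≢ root → key root < key v
    parent-adjacent    : ∀ {v} → v ≢ root → adj G v (parent v) ≡ true
    key-parent<        : ∀ {v} → v ≢ root → key (parent v) < key v
    key-parent-minimal : ∀ v {u} → adj G v u ≡ true → key (parent v) ≤ key u

  adjacent-parent : ∀ {v} → v ≢ root → adj G (parent v) v ≡ true
  adjacent-parent {v} v≢r = trans (adj-sym G (parent v) v) (parent-adjacent v≢r)

  parent-of-root-neighbour : ∀ {v} → adj G v root ≡ true → v ≢ root → parent v ≡ root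
  parent-of-root-neighbour {v} a v≢r with parent v ≟ᶠ root
  ... | yes p≡r = p≡r
  ... | no p≢r = contradiction (key-parent-minimal v a) (<⇒≱ (key-root< p≢r))

  parents-not-mutual : ∀ {v w} → v ≢ root → w ≢ root → parent v ≡ w → parent w ≢ v
  parents-not-mutual {v} {w} v≢r w≢r refl p≡v =
    <-asym (key-parent< v≢r) (subst (λ z → key z < key (parent v)) p≡v (key-parent< w≢r))

module BreadthFirst {n : ℕ} (G : SimpleGraph n) (r : Fin n) (connected : Connected G) where

  within : ℕ → Fin n → Bool
  within zero v = ⌊ v ≟ᶠ r ⌋
  within (suc t) v = within t v ∨ any (λ u → adj G v u ∧ within t u) (allFin n)

  within-reach : ∀ {v} → Reach G v r → Σ ℕ λ t → T (within t v)
  within-reach here = 0 , fromWitness refl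
  within-reach {v} (reach-step {v = u} a rest) with within-reach rest
  ... | t , u-within = suc t , Equivalence.from T-∨ (inj₂ (any⁺ _ (lose (∈-allFin u) u-step)))
    where
    u-step : T (adj G v u ∧ within t u)
    u-step = Equivalence.from T-∧ (Equivalence.from T-≡ a , u-within)

  within-suc⁻ : ∀ t {v} → T (within (suc t) v) →
                T (within t v) ⊎ Σ (Fin n) λ u → adj G v u ≡ true × T (within t u)
  within-suc⁻ t {v} w with Equivalence.to T-∨ w
  ... | inj₁ v-within = inj₁ v-within
  ... | inj₂ some with Any.satisfied (any⁻ _ (allFin n) some)
  ...   | u , u-step with Equivalence.to T-∧ u-step
  ...     | a , u-within = inj₂ (u , Equivalence.to T-≡ a , u-within)

  distanceBound : Fin n → ℕ
  distanceBound v = proj₁ (within-reach (connected v r))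

  distance : Fin n → ℕ
  distance v = least (λ t → within t v) (distanceBound v)

  distance-within : ∀ v → T (within (distance v) v)
  distance-within v = least-satisfies (λ t → within t v) (distanceBound v) ≤-refl (proj₂ (within-reach (connected v r)))

  distance-minimal : ∀ v {t} → T (within t v) → distance v ≤ t
  distance-minimal v {t} v-within with distance v ≤? t
  ... | yes d≤t = d≤t
  ... | no d≰t = contradiction v-within (least-minimal (λ t → within t v) (distanceBound v) (≰⇒> d≰t))

  distance-root : distance r ≡ 0
  distance-root = n≤0⇒n≡0 (distance-minimal r (fromWitness refl))

  closer-neighbour : ∀ {v} → v ≢ r → Σ (Fin n) λ u → adj G v u ≡ true × distance u < distance v
  closer-neighbour {v} v≢r with distance v in d≡ | distance-within v
  ... | zero | v-within = contradiction (toWitness v-within) v≢r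
  ... | suc d | v-within with within-suc⁻ d v-within
  ...   | inj₁ v-within' = ⊥-elim (1+n≰n (subst (_≤ d) d≡ (distance-minimal v v-within')))
  ...   | inj₂ (u , a , u-within) = u , a , s≤s (distance-minimal u u-within)

  distance-positive : ∀ {v} → v ≢ r → 0 < distance v
  distance-positive {v} v≢r with distance v | distance-within v
  ... | zero | v-within = contradiction (toWitness v-within) v≢r
  ... | suc _ | _ = s≤s z≤n

  instance
    _ : NonZero n
    _ = nonZeroIndex r

  opaque
    -- breadth-first order: by distance from r, ties broken by index
    key : Fin n → ℕ
    key v = toℕ v + distance v * n

    key-injective : ∀ {v w} → key v ≡ key w → v ≡ w
    key-injective {v} {w} eq = toℕ-injective (begin
      toℕ v                        ≡⟨ m<n⇒m%n≡m (toℕ<n v) ⟨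
      toℕ v % n                    ≡⟨ [m+kn]%n≡m%n (toℕ v) (distance v) n ⟨
      (toℕ v + distance v * n) % n ≡⟨ cong (_% n) eq ⟩
      (toℕ w + distance w * n) % n ≡⟨ [m+kn]%n≡m%n (toℕ w) (distance w) n ⟩
      toℕ w % n                    ≡⟨ m<n⇒m%n≡m (toℕ<n w) ⟩
      toℕ w                        ∎)
      where open ≡-Reasoning

    key-<-distance : ∀ {u v} → distance u < distance v → key u < key v
    key-<-distance {u} {v} d< = begin-strict
      toℕ u + distance u * n  <⟨ +-monoˡ-< (distance u * n) (toℕ<n u) ⟩
      n + distance u * n      ≤⟨ *-monoˡ-≤ n d< ⟩
      distance v * n          ≤⟨ m≤n+m (distance v * n) (toℕ v) ⟩
      toℕ v + distance v * n  ∎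
      where open ≤-Reasoning

    open Degrees G using (neighbours; ∈-neighbours; ∈-neighbours⁻)

    parent : Fin n → Fin n
    parent v = argmin key v (neighbours v)

    key-parent-minimal : ∀ v {u} → adj G v u ≡ true → key (parent v) ≤ key u
    key-parent-minimal v a = All.lookup (f[argmin]≤f[xs] v (neighbours v)) (∈-neighbours a)

    key-parent< : ∀ {v} → v ≢ r → key (parent v) < key v
    key-parent< v≢r with closer-neighbour v≢r
    ... | u , a , closer = ≤-<-trans (key-parent-minimal _ a) (key-<-distance closer)

    parent-adjacent : ∀ {v} → v ≢ r → adj G v (parent v) ≡ true
    parent-adjacent {v} v≢r with argmin-sel key v (neighbours v)
    ... | inj₁ p≡v = contradiction (subst (λ p → key p < key v) p≡v (key-parent< v≢r)) (<-irrefl refl)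
    ... | inj₂ p∈ = ∈-neighbours⁻ p∈

  tree : RootedTree G
  tree = record
    { root = r
    ; parent = parent
    ; key = key
    ; key-injective = key-injective
    ; key-root< = λ {v} v≢r → key-<-distance (subst (_< distance v) (sym distance-root) (distance-positive v≢r))
    ; parent-adjacent = parent-adjacent
    ; key-parent< = key-parent<
    ; key-parent-minimal = key-parent-minimal
    }

-- code v j is the colour at distance j (1 ≤ j ≤ k) from parent v on the path of the tree edge to v,
-- so code v k is the colour of v itself; paths of edges outside the tree are coloured nonTree.
module TreeColouring {n : ℕ} {G : SimpleGraph n} (m : ℕ) (T : RootedTree G) {s : ℕ}
                     (lab : Fin n → Fin s) (code : Fin n → ℕ → Fin s) (nonTree : Fin s)
                     (lab≡code : ∀ {v} → v ≢ RootedTree.root T → lab v ≡ code v (suc (suc m))) where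
  open Subdivision G m
  open RootedTree T

  _isChildOf_ : Fin n → Fin n → Set
  v isChildOf p = v ≢ root × parent v ≡ p

  _isChildOf?_ : ∀ v p → Dec (v isChildOf p)
  v isChildOf? p = ¬? (v ≟ᶠ root) ×-dec (parent v ≟ᶠ p)

  internalColour : Edge G → ℕ → Fin s
  internalColour e j with tgt e isChildOf? src e | src e isChildOf? tgt e
  ... | yes _ | _ = code (tgt e) j
  ... | no _ | yes _ = code (src e) (k ∸ j)
  ... | no _ | no _ = nonTree

  colour : V → Fin s
  colour (inj₁ v) = lab v
  colour (inj₂ (e , i)) = internalColour e (suc (toℕ i))

  internalColour-tgt : ∀ e {j} → tgt e isChildOf src e → internalColour e j ≡ code (tgt e) j
  internalColour-tgt e c with tgt e isChildOf? src e
  ... | yes _ = refl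
  ... | no ¬c = contradiction c ¬c

  internalColour-src : ∀ e {j} → src e isChildOf tgt e → internalColour e j ≡ code (src e) (k ∸ j)
  internalColour-src e (s≢r , ps) with tgt e isChildOf? src e | src e isChildOf? tgt e
  ... | yes (t≢r , pt) | _ = contradiction ps (parents-not-mutual t≢r s≢r pt)
  ... | no _ | yes _ = refl
  ... | no _ | no ¬c = contradiction (s≢r , ps) ¬c

  internalColour-nonTree : ∀ e {j} → ¬ tgt e isChildOf src e → ¬ src e isChildOf tgt e → internalColour e j ≡ nonTree
  internalColour-nonTree e ¬c ¬c' with tgt e isChildOf? src e | src e isChildOf? tgt e
  ... | yes c | _ = contradiction c ¬c
  ... | no _ | yes c' = contradiction c' ¬c'
  ... | no _ | no _ = refl

  colour-interior : ∀ e b {j} → 0 < j → j < k → colour (legVertex (e , b) j) ≡ internalColour e (orient b j)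
  colour-interior e b 0<j j<k with legVertex-interior (e , b) 0<j j<k
  ... | i , 1+i≡j' , eq rewrite eq = cong (internalColour e) 1+i≡j'

  colour-nonTree-leg : ∀ ℓ → ¬ end ℓ isChildOf start ℓ → ¬ start ℓ isChildOf end ℓ → colour (legVertex ℓ 1) ≡ nonTree
  colour-nonTree-leg (e , false) ¬c ¬c' = trans (colour-interior e false (s≤s z≤n) (s≤s (s≤s z≤n))) (internalColour-nonTree e ¬c ¬c')
  colour-nonTree-leg (e , true) ¬c ¬c' = trans (colour-interior e true (s≤s z≤n) (s≤s (s≤s z≤n))) (internalColour-nonTree e ¬c' ¬c)

  leg-kind : ∀ ℓ → end ℓ isChildOf start ℓ ⊎ start ℓ isChildOf end ℓ ⊎ colour (legVertex ℓ 1) ≡ nonTree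
  leg-kind ℓ with end ℓ isChildOf? start ℓ | start ℓ isChildOf? end ℓ
  ... | yes down | _ = inj₁ down
  ... | no _ | yes up = inj₂ (inj₁ up)
  ... | no ¬down | no ¬up = inj₂ (inj₂ (colour-nonTree-leg ℓ ¬down ¬up))

  data Placement (x : V) : Set where
    atRoot  : x ≡ inj₁ root → Placement x
    offTree : colour x ≡ nonTree → Placement x
    onTree  : ∀ ℓ {j} → end ℓ isChildOf start ℓ → 0 < j → j ≤ k → x ≡ legVertex ℓ j → Placement x

  placement : ∀ x → Placement x
  placement (inj₁ v) with v ≟ᶠ root
  ... | yes v≡r = atRoot (cong inj₁ v≡r)
  ... | no v≢r with legFor (adjacent-parent v≢r)
  ...   | ℓ , s≡p , e≡v = onTree ℓ (subst (_≢ root) (sym e≡v) v≢r , trans (cong parent e≡v) (sym s≡p)) (s≤s z≤n) ≤-refl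
                                 (trans (cong inj₁ (sym e≡v)) (sym (legVertex-end ℓ)))
  placement (inj₂ (e , i)) with tgt e isChildOf? src e | src e isChildOf? tgt e
  ... | yes c | _ = onTree (e , false) c (s≤s z≤n) (<⇒≤ (s≤s (toℕ<n i))) (sym (pathVertex-internal e i))
  ... | no _ | yes c = onTree (e , true) c (m<n⇒0<n∸m (s≤s (toℕ<n i))) (m∸n≤m k (suc (toℕ i)))
                             (trans (sym (pathVertex-internal e i)) (cong (pathVertex e) (sym (m∸[m∸n]≡n (<⇒≤ (s≤s (toℕ<n i)))))))
  ... | no ¬c | no ¬c' = offTree (internalColour-nonTree e ¬c ¬c')

  colour-towards-child : ∀ ℓ → end ℓ isChildOf start ℓ → ∀ {j} → 0 < j → j ≤ k → colour (legVertex ℓ j) ≡ code (end ℓ) j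
  colour-towards-child ℓ c 0<j j≤k with m≤n⇒m<n∨m≡n j≤k
  colour-towards-child ℓ (e≢r , _) 0<j j≤k | inj₂ refl = trans (cong colour (legVertex-end ℓ)) (lab≡code e≢r)
  colour-towards-child (e , false) c 0<j j≤k | inj₁ j<k = trans (colour-interior e false 0<j j<k) (internalColour-tgt e c)
  colour-towards-child (e , true) c {j} 0<j j≤k | inj₁ j<k =
    trans (colour-interior e true 0<j j<k) (trans (internalColour-src e c) (cong (code (src e)) (m∸[m∸n]≡n j≤k)))

  colour-towards-parent : ∀ ℓ → start ℓ isChildOf end ℓ → ∀ {j} → 0 < j → j < k → colour (legVertex ℓ j) ≡ code (start ℓ) (k ∸ j)
  colour-towards-parent (e , b) c {j} 0<j j<k = trans (cong colour (legVertex-reverse (e , b) (<⇒≤ j<k))) (reversed b c)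
    where
    reversed : ∀ b → start (e , b) isChildOf end (e , b) → colour (legVertex (e , not b) (k ∸ j)) ≡ code (start (e , b)) (k ∸ j)
    reversed false c = colour-towards-child (e , true) c (m<n⇒0<n∸m j<k) (m∸n≤m k j)
    reversed true c = colour-towards-child (e , false) c (m<n⇒0<n∸m j<k) (m∸n≤m k j)

  SiblingsSeparated : Set
  SiblingsSeparated = ∀ {v w} → v ≢ root → w ≢ root → parent v ≡ parent w →
                      (∀ {j} → 0 < j → j ≤ k → code v j ≡ code w j) → v ≡ w

  module Rigidity (separated : SiblingsSeparated) (σ : V ↔ V) (aut : IsAutomorphism _~_ σ)
                  (preserved : ∀ x → colour (Inverse.to σ x) ≡ colour x)
                  (root-fixed : Inverse.to σ (inj₁ root) ≡ inj₁ root) where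
    open Automorphism σ aut

    Fixed : Fin n → Set
    Fixed v = to (inj₁ v) ≡ inj₁ v

    -- σ maps the tree edge above v to an edge at parent v; its far end w is v itself,
    -- being either a sibling with the same code or a vertex already known to be fixed
    fixed-child : ∀ {v} → v ≢ root → Fixed (parent v) →
                  (∀ {w} → w ≢ root → key (parent w) < key (parent v) → Fixed w) → Fixed v
    fixed-child {v} v≢r parent-fixed earlier-fixed with legFor (adjacent-parent v≢r)
    ... | ℓ , s≡p , e≡v with map-leg ℓ (subst (λ p → to (inj₁ p) ≡ inj₁ (parent v)) (sym s≡p) parent-fixed)
    ...   | ℓ' , s'≡p , along = trans to-v (cong inj₁ (sym v≡w))
      where
      w : Fin n
      w = end ℓ'

      to-v : to (inj₁ v) ≡ inj₁ w
      to-v = trans (cong to (trans (cong inj₁ (sym e≡v)) (sym (legVertex-end ℓ)))) (trans (along ≤-refl) (legVertex-end ℓ'))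

      ℓ-tree : end ℓ isChildOf start ℓ
      ℓ-tree = subst (_≢ root) (sym e≡v) v≢r , trans (cong parent e≡v) (sym s≡p)

      v≡w : v ≡ w
      v≡w with w ≟ᶠ root
      ... | yes w≡r = trans (inj₁-injective (to-injective (trans to-v (trans (cong inj₁ w≡r) (sym root-fixed))))) (sym w≡r)
      ... | no w≢r with parent w ≟ᶠ parent v
      ...   | yes pw≡pv = separated v≢r w≢r (sym pw≡pv) same-code
        where
        same-code : ∀ {j} → 0 < j → j ≤ k → code v j ≡ code w j
        same-code {j} 0<j j≤k = begin
          code v j                   ≡⟨ cong (λ u → code u j) e≡v ⟨
          code (end ℓ) j             ≡⟨ colour-towards-child ℓ ℓ-tree 0<j j≤k ⟨
          colour (legVertex ℓ j)     ≡⟨ preserved (legVertex ℓ j) ⟨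
          colour (to (legVertex ℓ j)) ≡⟨ cong colour (along j≤k) ⟩
          colour (legVertex ℓ' j)    ≡⟨ colour-towards-child ℓ' (w≢r , trans pw≡pv (sym s'≡p)) 0<j j≤k ⟩
          code w j                   ∎
          where open ≡-Reasoning
      ...   | no pw≢pv = inj₁-injective (to-injective (trans to-v (sym (earlier-fixed w≢r earlier))))
        where
        w~pv : adj G w (parent v) ≡ true
        w~pv = subst (λ p → adj G w p ≡ true) s'≡p (trans (adj-sym G (end ℓ') (start ℓ')) (leg-adjacent ℓ'))
        earlier : key (parent w) < key (parent v)
        earlier = ≤∧≢⇒< (key-parent-minimal w w~pv) (pw≢pv ∘ key-injective)

    fixed-original : ∀ v → Fixed v
    fixed-original v with v ≟ᶠ root
    ... | yes refl = root-fixed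
    ... | no v≢r = <-rec Goal fixed-at (key (parent v)) v≢r refl
      where
      Goal : ℕ → Set
      Goal t = ∀ {v} → v ≢ root → key (parent v) ≡ t → Fixed v
      fixed-at : ∀ t → (∀ {t'} → t' < t → Goal t') → Goal t
      fixed-at t earlier {v} v≢r refl = fixed-child v≢r parent-fixed (λ w≢r lt → earlier lt w≢r refl)
        where
        parent-fixed : Fixed (parent v)
        parent-fixed with parent v ≟ᶠ root
        ... | yes p≡r = subst Fixed (sym p≡r) root-fixed
        ... | no p≢r = earlier (key-parent< p≢r) p≢r refl

    fixed : ∀ x → to x ≡ x
    fixed (inj₁ v) = fixed-original v
    fixed (inj₂ (e , i)) with map-leg (e , false) (fixed-original (src e))
    ... | ℓ' , s'≡ , along with leg-unique {e , false} {ℓ'} (sym s'≡) end≡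
      where
      end≡ : tgt e ≡ end ℓ'
      end≡ = inj₁-injective (trans (sym (fixed-original (tgt e)))
               (trans (cong to (sym (pathVertex-end e))) (trans (along ≤-refl) (legVertex-end ℓ'))))
    ...   | refl = trans (cong to (sym (pathVertex-internal e i))) (trans (along (s≤s (<⇒≤ (toℕ<n i)))) (pathVertex-internal e i))

  distinguishing : SiblingsSeparated →
                   (∀ σ → IsAutomorphism _~_ σ → (∀ x → colour (Inverse.to σ x) ≡ colour x) → Inverse.to σ (inj₁ root) ≡ inj₁ root) →
                   IsDistinguishing _~_ s colour
  distinguishing separated root-fixed σ aut preserved = Rigidity.fixed separated σ aut preserved (root-fixed σ aut preserved)

module LargeDegree {n : ℕ} (G : SimpleGraph n) (m : ℕ) (connected : Connected G)
                   (r y₀ : Fin n) (r~y₀ : adj G r y₀ ≡ true)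
                   (s : ℕ) (Δ≤Sᵏ : maxDegree G ≤ suc (suc s) ^ suc (suc m)) where
  open Subdivision G m
  open Degrees G
  open BreadthFirst G r connected using (tree)
  open RootedTree tree

  S : ℕ
  S = suc (suc s)

  c₀ c₁ : Fin S
  c₀ = fz
  c₁ = fs fz

  Sᵏ : ℕ
  Sᵏ = S ^ k

  instance
    _ : NonZero Sᵏ
    _ = m^n≢0 S k

  Digits : Set
  Digits = Fin k → Fin S

  -- digit j ∸ 1 is the colour at distance j (1 ≤ j ≤ k) from the parent
  at : Digits → ℕ → Fin S
  at d j = d ((j ∸ 1) mod k)

  toℕ-index : ∀ {j} → j ≤ k → toℕ ((j ∸ 1) mod k) ≡ j ∸ 1
  toℕ-index {zero} _ = toℕ-fromℕ< (m%n<n 0 k)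
  toℕ-index {suc j} j<k = trans (toℕ-fromℕ< _) (m<n⇒m%n≡m j<k)

  at-injective : ∀ (d d' : Digits) → (∀ {j} → 0 < j → j ≤ k → at d j ≡ at d' j) → ∀ i → d i ≡ d' i
  at-injective d d' eq i = subst (λ i' → d i' ≡ d' i') index (eq (s≤s z≤n) (toℕ<n i))
    where
    index : (toℕ i) mod k ≡ i
    index = toℕ-injective (toℕ-index {suc (toℕ i)} (toℕ<n i))

  at-agree : ∀ {d d' : Digits} → (∀ {j} → 0 < j → j < k → at d j ≡ at d' j) → at d k ≡ at d' k →
             ∀ {j} → 0 < j → j ≤ k → at d j ≡ at d' j
  at-agree below end 0<j j≤k with m≤n⇒m<n∨m≡n j≤k
  ... | inj₁ j<k = below 0<j j<k
  ... | inj₂ refl = end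

  -- rank p v < Δ ≤ Sᵏ for a neighbour v of p, where the mod is the identity
  slot : Fin n → Fin n → Fin Sᵏ
  slot p v = rank p v mod Sᵏ

  slot-injective : ∀ {p v w} → adj G p v ≡ true → adj G p w ≡ true → slot p v ≡ slot p w → v ≡ w
  slot-injective av aw eq = rank-injective av aw (mod-injective (rank<Sᵏ av) (rank<Sᵏ aw) eq)
    where
    rank<Sᵏ : ∀ {p v} → adj G p v ≡ true → rank p v < Sᵏ
    rank<Sᵏ {p} a = <-≤-trans (rank<degree a) (≤-trans (degree≤maxDegree p) Δ≤Sᵏ)

  allZero lastOne : Digits
  allZero _ = c₀
  lastOne i with toℕ i ≟ suc m
  ... | yes _ = c₁
  ... | no _ = c₀

  -- the slot swapped with the forbidden digits: that of p's parent, which is not a child of p,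
  -- or at the root that of y₀, whose leg becomes the one all-c₀ leg at a c₁-coloured vertex
  anchor : Fin n → Fin Sᵏ
  anchor p with p ≟ᶠ r
  ... | yes _ = slot r y₀
  ... | no _ = slot p (parent p)

  -- digits which, below a vertex of colour x, would make a c₀-coloured leg at a c₁-coloured vertex
  forbidden : Fin n → Fin S → Digits
  forbidden p x with p ≟ᶠ r | x ≟ᶠ c₀
  ... | no _ | yes _ = lastOne
  ... | _ | _ = allZero

  number : Fin n → Fin S → Fin n → Fin Sᵏ
  number p x v = transpose (anchor p) (funToFin (forbidden p x)) (slot p v)

  labelWithFuel : ℕ → Fin n → Fin S
  labelWithFuel zero _ = c₁
  labelWithFuel (suc f) v with v ≟ᶠ r
  ... | yes _ = c₁
  ... | no _ = at (finToFun (number (parent v) (labelWithFuel f (parent v)) v)) k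

  labelWithFuel-stable : ∀ {f f' v} → key v < f → key v < f' → labelWithFuel f v ≡ labelWithFuel f' v
  labelWithFuel-stable {suc f} {suc f'} {v} (s≤s v<f) (s≤s v<f') with v ≟ᶠ r
  ... | yes _ = refl
  ... | no v≢r = cong (λ x → at (finToFun (number (parent v) x v)) k)
                      (labelWithFuel-stable (<-≤-trans (key-parent< v≢r) v<f) (<-≤-trans (key-parent< v≢r) v<f'))

  lab : Fin n → Fin S
  lab v = labelWithFuel (suc (key v)) v

  digits : Fin n → Digits
  digits v = finToFun (number (parent v) (lab (parent v)) v)

  code : Fin n → ℕ → Fin S
  code v = at (digits v)

  lab-root : lab r ≡ c₁
  lab-root with r ≟ᶠ r
  ... | yes _ = refl
  ... | no r≢r = contradiction refl r≢r

  lab≡code : ∀ {v} → v ≢ r → lab v ≡ code v k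
  lab≡code {v} v≢r with v ≟ᶠ r
  ... | yes v≡r = contradiction v≡r v≢r
  ... | no _ = cong (λ x → at (finToFun (number (parent v) x v)) k)
                    (labelWithFuel-stable (key-parent< v≢r) ≤-refl)

  open TreeColouring m tree lab code c₁ lab≡code public

  anchor-root : anchor r ≡ slot r y₀
  anchor-root with r ≟ᶠ r
  ... | yes _ = refl
  ... | no r≢r = contradiction refl r≢r

  anchor-nonroot : ∀ {p} → p ≢ r → anchor p ≡ slot p (parent p)
  anchor-nonroot {p} p≢r with p ≟ᶠ r
  ... | yes p≡r = contradiction p≡r p≢r
  ... | no _ = refl

  forbidden-root : ∀ x → forbidden r x ≡ allZero
  forbidden-root x with r ≟ᶠ r | x ≟ᶠ c₀
  ... | no r≢r | _ = contradiction refl r≢r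
  ... | yes _ | yes _ = refl
  ... | yes _ | no _ = refl

  forbidden-c₀ : ∀ {p} → p ≢ r → forbidden p c₀ ≡ lastOne
  forbidden-c₀ {p} p≢r with p ≟ᶠ r
  ... | yes p≡r = contradiction p≡r p≢r
  ... | no _ = refl

  forbidden-c₁ : ∀ {p} → p ≢ r → forbidden p c₁ ≡ allZero
  forbidden-c₁ {p} p≢r with p ≟ᶠ r
  ... | yes p≡r = contradiction p≡r p≢r
  ... | no _ = refl

  at-lastOne-end : at lastOne k ≡ c₁
  at-lastOne-end with toℕ ((k ∸ 1) mod k) ≟ suc m | toℕ-index {k} ≤-refl
  ... | yes _ | _ = refl
  ... | no ne | eq = contradiction eq ne

  at-lastOne-interior : ∀ {j} → j < k → at lastOne j ≡ c₀
  at-lastOne-interior {j} j<k with toℕ ((j ∸ 1) mod k) ≟ suc m | toℕ-index (<⇒≤ j<k)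
  ... | no _ | _ = refl
  ... | yes eq | eq' = contradiction (trans (sym eq') eq) (<⇒≢ (≤-<-trans (∸-monoˡ-≤ 1 (s≤s⁻¹ j<k)) ≤-refl))

  separated : SiblingsSeparated
  separated {v} {w} v≢r w≢r pv≡pw same = slot-injective (adjacent-parent v≢r) w~pv (transpose-injective _ _ numbers-equal)
    where
    w~pv : adj G (parent v) w ≡ true
    w~pv = subst (λ p → adj G p w ≡ true) (sym pv≡pw) (adjacent-parent w≢r)
    numbers-equal : number (parent v) (lab (parent v)) v ≡ number (parent v) (lab (parent v)) w
    numbers-equal = trans (finToFun-injective (at-injective (digits v) (digits w) same))
                          (cong (λ p → number p (lab p) w) (sym pv≡pw))

  forbidden-digits-unused : ∀ {v} → v ≢ r → parent v ≢ r → ∀ {d} → forbidden (parent v) (lab (parent v)) ≡ d →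
                            ¬ (∀ i → digits v i ≡ d i)
  forbidden-digits-unused {v} v≢r p≢r refl digits≡ = parents-not-mutual v≢r p≢r refl (sym v≡pp)
    where
    p : Fin n
    p = parent v
    hits : number p (lab p) v ≡ funToFin (forbidden p (lab p))
    hits = finToFun-injective (λ i → trans (digits≡ i) (sym (finToFun-funToFin (forbidden p (lab p)) i)))
    v≡pp : v ≡ parent p
    v≡pp = slot-injective (adjacent-parent v≢r) (parent-adjacent p≢r) (trans (transpose≡ʳ⇒≡ˡ _ _ hits) (anchor-nonroot p≢r))

  y₀≢r : y₀ ≢ r
  y₀≢r = adj-irrefl r~y₀ ∘ sym

  parent-y₀ : parent y₀ ≡ r
  parent-y₀ = parent-of-root-neighbour (trans (adj-sym G y₀ r) r~y₀) y₀≢r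

  digits-y₀ : ∀ i → digits y₀ i ≡ c₀
  digits-y₀ i = begin
    finToFun (number (parent y₀) (lab (parent y₀)) y₀) i ≡⟨ cong (λ p → finToFun (number p (lab p) y₀) i) parent-y₀ ⟩
    finToFun (number r (lab r) y₀) i                     ≡⟨ cong (λ z → finToFun z i) number-y₀ ⟩
    finToFun (funToFin allZero) i                        ≡⟨ finToFun-funToFin allZero i ⟩
    c₀                                                   ∎
    where
    open ≡-Reasoning
    number-y₀ : number r (lab r) y₀ ≡ funToFin allZero
    number-y₀ rewrite anchor-root | forbidden-root (lab r) = transpose-matchˡ (slot r y₀) (funToFin allZero)

  c₁≢c₀ : c₁ ≢ c₀
  c₁≢c₀ ()

  AllC₀ : Leg → Set
  AllC₀ ℓ = ∀ {j} → 0 < j → j ≤ k → colour (legVertex ℓ j) ≡ c₀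

  c₀-leg-not-down : ∀ ℓ → start ℓ ≢ r → lab (start ℓ) ≡ c₁ → end ℓ isChildOf start ℓ → ¬ AllC₀ ℓ
  c₀-leg-not-down ℓ q≢r lab-q (w≢r , pw≡q) c₀-leg =
    forbidden-digits-unused w≢r (q≢r ∘ trans (sym pw≡q)) forbidden≡ digits≡
    where
    forbidden≡ : forbidden (parent (end ℓ)) (lab (parent (end ℓ))) ≡ allZero
    forbidden≡ = trans (cong (λ p → forbidden p (lab p)) pw≡q) (trans (cong (forbidden (start ℓ)) lab-q) (forbidden-c₁ q≢r))
    digits≡ : ∀ i → digits (end ℓ) i ≡ allZero i
    digits≡ = at-injective (digits (end ℓ)) allZero
                (λ 0<j j≤k → trans (sym (colour-towards-child ℓ (w≢r , pw≡q) 0<j j≤k)) (c₀-leg 0<j j≤k))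

  c₀-leg-not-up : ∀ ℓ → lab (start ℓ) ≡ c₁ → start ℓ isChildOf end ℓ → ¬ AllC₀ ℓ
  c₀-leg-not-up ℓ lab-q (q≢r , pq≡w) c₀-leg = forbidden-digits-unused q≢r (w≢r ∘ trans (sym pq≡w)) forbidden≡ digits≡
    where
    lab-w : lab (end ℓ) ≡ c₀
    lab-w = trans (cong colour (sym (legVertex-end ℓ))) (c₀-leg (s≤s z≤n) ≤-refl)
    w≢r : end ℓ ≢ r
    w≢r w≡r = c₁≢c₀ (trans (sym lab-root) (trans (cong lab (sym w≡r)) lab-w))
    forbidden≡ : forbidden (parent (start ℓ)) (lab (parent (start ℓ))) ≡ lastOne
    forbidden≡ = trans (cong (λ p → forbidden p (lab p)) pq≡w) (trans (cong (forbidden (end ℓ)) lab-w) (forbidden-c₀ w≢r))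
    below-q : ∀ {j} → 0 < j → j < k → code (start ℓ) j ≡ at lastOne j
    below-q {j} 0<j j<k = begin
      code (start ℓ) j                   ≡⟨ cong (code (start ℓ)) (m∸[m∸n]≡n (<⇒≤ j<k)) ⟨
      code (start ℓ) (k ∸ (k ∸ j))       ≡⟨ colour-towards-parent ℓ (q≢r , pq≡w) (m<n⇒0<n∸m j<k) (∸-monoʳ-< 0<j (<⇒≤ j<k)) ⟨
      colour (legVertex ℓ (k ∸ j))       ≡⟨ c₀-leg (m<n⇒0<n∸m j<k) (m∸n≤m k j) ⟩
      c₀                                 ≡⟨ at-lastOne-interior j<k ⟨
      at lastOne j                       ∎
      where open ≡-Reasoning
    digits≡ : ∀ i → digits (start ℓ) i ≡ lastOne i
    digits≡ = at-injective (digits (start ℓ)) lastOne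
                (at-agree {digits (start ℓ)} {lastOne} below-q (trans (sym (lab≡code q≢r)) (trans lab-q (sym at-lastOne-end))))

  c₀-leg-starts-at-root : ∀ ℓ → lab (start ℓ) ≡ c₁ → AllC₀ ℓ → start ℓ ≡ r
  c₀-leg-starts-at-root ℓ lab-q c₀-leg = decidable-stable (start ℓ ≟ᶠ r) away
    where
    away : start ℓ ≢ r → ⊥
    away q≢r with leg-kind ℓ
    ... | inj₁ down = c₀-leg-not-down ℓ q≢r lab-q down c₀-leg
    ... | inj₂ (inj₁ up) = c₀-leg-not-up ℓ lab-q up c₀-leg
    ... | inj₂ (inj₂ nonTree) = c₁≢c₀ (trans (sym nonTree) (c₀-leg (s≤s z≤n) (s≤s z≤n)))

  ℓ₀ : Leg
  ℓ₀ = proj₁ (legFor r~y₀)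

  start-ℓ₀ : start ℓ₀ ≡ r
  start-ℓ₀ = proj₁ (proj₂ (legFor r~y₀))

  end-ℓ₀ : end ℓ₀ ≡ y₀
  end-ℓ₀ = proj₂ (proj₂ (legFor r~y₀))

  ℓ₀-c₀ : AllC₀ ℓ₀
  ℓ₀-c₀ {j} 0<j j≤k = begin
    colour (legVertex ℓ₀ j) ≡⟨ colour-towards-child ℓ₀ ℓ₀-tree 0<j j≤k ⟩
    code (end ℓ₀) j         ≡⟨ cong (λ y → code y j) end-ℓ₀ ⟩
    code y₀ j               ≡⟨ digits-y₀ ((j ∸ 1) mod k) ⟩
    c₀                      ∎
    where
    open ≡-Reasoning
    ℓ₀-tree : end ℓ₀ isChildOf start ℓ₀
    ℓ₀-tree = subst (_≢ r) (sym end-ℓ₀) y₀≢r , trans (cong parent end-ℓ₀) (trans parent-y₀ (sym start-ℓ₀))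

  module _ (σ : V ↔ V) (aut : IsAutomorphism _~_ σ) (preserved : ∀ x → colour (Inverse.to σ x) ≡ colour x) where
    open Automorphism σ aut

    -- σ maps the c₀-leg from r towards y₀ to a c₀-leg from the image of r
    original-image-is-root : ∀ {q} → to (inj₁ r) ≡ inj₁ q → q ≡ r
    original-image-is-root {q} tq = trans (sym start-ℓ') (c₀-leg-starts-at-root ℓ' lab-start c₀-leg)
      where
      image : Σ Leg λ ℓ' → start ℓ' ≡ q × (∀ {j} → j ≤ k → to (legVertex ℓ₀ j) ≡ legVertex ℓ' j)
      image = map-leg ℓ₀ (subst (λ p → to (inj₁ p) ≡ inj₁ q) (sym start-ℓ₀) tq)
      ℓ' : Leg
      ℓ' = proj₁ image
      start-ℓ' : start ℓ' ≡ q
      start-ℓ' = proj₁ (proj₂ image)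
      lab-start : lab (start ℓ') ≡ c₁
      lab-start = trans (cong lab start-ℓ') (trans (cong colour (sym tq)) (trans (preserved (inj₁ r)) lab-root))
      c₀-leg : AllC₀ ℓ'
      c₀-leg {j} 0<j j≤k = trans (cong colour (sym (proj₂ (proj₂ image) j≤k)))
                                 (trans (preserved (legVertex ℓ₀ j)) (ℓ₀-c₀ 0<j j≤k))

    root-fixed : ∀ {y₁ y₂} → adj G r y₁ ≡ true → adj G r y₂ ≡ true → y₀ ≢ y₁ → y₀ ≢ y₂ → y₁ ≢ y₂ →
                 to (inj₁ r) ≡ inj₁ r
    root-fixed r~y₁ r~y₂ y₀≢y₁ y₀≢y₂ y₁≢y₂ = trans (proj₂ image) (cong inj₁ (original-image-is-root (proj₂ image)))
      where
      image : Σ (Fin n) λ q → to (inj₁ r) ≡ inj₁ q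
      image = branch-image-original r~y₀ r~y₁ r~y₂ y₀≢y₁ y₀≢y₂ y₁≢y₂

module SmallDegree {n : ℕ} (G : SimpleGraph n) (m : ℕ) (connected : Connected G)
                   (r y₁ y₂ : Fin n) (r~y₁ : adj G r y₁ ≡ true) (r~y₂ : adj G r y₂ ≡ true) (y₁≢y₂ : y₁ ≢ y₂)
                   (Δ≤2 : maxDegree G ≤ 2) where
  open Subdivision G m
  open Degrees G
  open BreadthFirst G r connected using (tree)
  open RootedTree tree

  no-three-neighbours : ∀ {p x y z} → adj G p x ≡ true → adj G p y ≡ true → adj G p z ≡ true →
                        x ≢ y → x ≢ z → y ≢ z → ⊥
  no-three-neighbours {p} ax ay az x≢y x≢z y≢z =
    1+n≰n (≤-trans (unique-neighbours⇒≤degree ((x≢y ∷ x≢z ∷ []) ∷ (y≢z ∷ []) ∷ [] ∷ []) (ax ∷ ay ∷ az ∷ []))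
                   (≤-trans (degree≤maxDegree p) Δ≤2))

  root-neighbours : ∀ {v} → adj G r v ≡ true → v ≡ y₁ ⊎ v ≡ y₂
  root-neighbours {v} a with v ≟ᶠ y₁ | v ≟ᶠ y₂
  ... | yes v≡y₁ | _ = inj₁ v≡y₁
  ... | no _ | yes v≡y₂ = inj₂ v≡y₂
  ... | no v≢y₁ | no v≢y₂ = ⊥-elim (no-three-neighbours r~y₁ r~y₂ a y₁≢y₂ (v≢y₁ ∘ sym) (v≢y₂ ∘ sym))

  plain marked : Fin 2
  plain = fz
  marked = fs fz

  markAt : ℕ → ℕ → Fin 2
  markAt i j with j ≟ i
  ... | yes _ = marked
  ... | no _ = plain

  markAt-marked : ∀ {i j} → markAt i j ≡ marked → j ≡ i
  markAt-marked {i} {j} eq with j ≟ i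
  ... | yes j≡i = j≡i
  markAt-marked () | no _

  -- the legs from r to y₁ and to y₂ carry a single marked vertex, at distance 1 and 2 respectively
  code : Fin n → ℕ → Fin 2
  code v j with parent v ≟ᶠ r | v ≟ᶠ y₁
  ... | yes _ | yes _ = markAt 1 j
  ... | yes _ | no _ = markAt 2 j
  ... | no _ | _ = plain

  lab : Fin n → Fin 2
  lab v with v ≟ᶠ r
  ... | yes _ = marked
  ... | no _ = code v k

  lab≡code : ∀ {v} → v ≢ r → lab v ≡ code v k
  lab≡code {v} v≢r with v ≟ᶠ r
  ... | yes v≡r = contradiction v≡r v≢r
  ... | no _ = refl

  open TreeColouring m tree lab code plain lab≡code public

  y₁≢r : y₁ ≢ r
  y₁≢r = adj-irrefl r~y₁ ∘ sym

  y₂≢r : y₂ ≢ r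
  y₂≢r = adj-irrefl r~y₂ ∘ sym

  parent-y₁ : parent y₁ ≡ r
  parent-y₁ = parent-of-root-neighbour (trans (adj-sym G y₁ r) r~y₁) y₁≢r

  parent-y₂ : parent y₂ ≡ r
  parent-y₂ = parent-of-root-neighbour (trans (adj-sym G y₂ r) r~y₂) y₂≢r

  code-y₁ : ∀ j → code y₁ j ≡ markAt 1 j
  code-y₁ j with parent y₁ ≟ᶠ r | y₁ ≟ᶠ y₁
  ... | yes _ | yes _ = refl
  ... | yes _ | no y₁≢y₁ = contradiction refl y₁≢y₁
  ... | no p≢r | _ = contradiction parent-y₁ p≢r

  code-y₂ : ∀ j → code y₂ j ≡ markAt 2 j
  code-y₂ j with parent y₂ ≟ᶠ r | y₂ ≟ᶠ y₁
  ... | yes _ | yes y₂≡y₁ = contradiction (sym y₂≡y₁) y₁≢y₂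
  ... | yes _ | no _ = refl
  ... | no p≢r | _ = contradiction parent-y₂ p≢r

  child-of-root : ∀ {v} → v ≢ r → parent v ≡ r → v ≡ y₁ ⊎ v ≡ y₂
  child-of-root {v} v≢r p≡r = root-neighbours (subst (λ p → adj G p v ≡ true) p≡r (adjacent-parent v≢r))

  code-marked : ∀ {v j} → v ≢ r → code v j ≡ marked → parent v ≡ r × (v ≡ y₁ × j ≡ 1 ⊎ v ≡ y₂ × j ≡ 2)
  code-marked {v} v≢r eq with parent v ≟ᶠ r | v ≟ᶠ y₁
  ... | yes p≡r | yes v≡y₁ = p≡r , inj₁ (v≡y₁ , markAt-marked eq)
  ... | yes p≡r | no v≢y₁ with child-of-root v≢r p≡r
  ...   | inj₁ v≡y₁ = contradiction v≡y₁ v≢y₁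
  ...   | inj₂ v≡y₂ = p≡r , inj₂ (v≡y₂ , markAt-marked eq)
  code-marked _ () | no _ | _

  separated : SiblingsSeparated
  separated {v} {w} v≢r w≢r pv≡pw same with toSum (v ≟ᶠ w)
  ... | inj₁ v≡w = v≡w
  ... | inj₂ v≢w with toSum (parent v ≟ᶠ r)
  ...   | inj₂ p≢r = ⊥-elim (no-three-neighbours (adjacent-parent v≢r) pv~w (parent-adjacent p≢r) v≢w
                              (parents-not-mutual v≢r p≢r refl ∘ sym) (parents-not-mutual w≢r p≢r (sym pv≡pw) ∘ sym))
    where
    pv~w : adj G (parent v) w ≡ true
    pv~w = subst (λ p → adj G p w ≡ true) (sym pv≡pw) (adjacent-parent w≢r)
  ...   | inj₁ p≡r with child-of-root v≢r p≡r | child-of-root w≢r (trans (sym pv≡pw) p≡r)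
  ...     | inj₁ v≡y₁ | inj₁ w≡y₁ = contradiction (trans v≡y₁ (sym w≡y₁)) v≢w
  ...     | inj₂ v≡y₂ | inj₂ w≡y₂ = contradiction (trans v≡y₂ (sym w≡y₂)) v≢w
  ...     | inj₁ refl | inj₂ refl with () ← trans (sym (code-y₁ 1)) (trans (same (s≤s z≤n) (s≤s z≤n)) (code-y₂ 1))
  ...     | inj₂ refl | inj₁ refl with () ← trans (sym (code-y₁ 1)) (trans (sym (same (s≤s z≤n) (s≤s z≤n))) (code-y₂ 1))

  ℓA ℓB : Leg
  ℓA = proj₁ (legFor r~y₁)
  ℓB = proj₁ (legFor r~y₂)

  start-ℓA : start ℓA ≡ r
  start-ℓA = proj₁ (proj₂ (legFor r~y₁))

  start-ℓB : start ℓB ≡ r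
  start-ℓB = proj₁ (proj₂ (legFor r~y₂))

  end-ℓA : end ℓA ≡ y₁
  end-ℓA = proj₂ (proj₂ (legFor r~y₁))

  end-ℓB : end ℓB ≡ y₂
  end-ℓB = proj₂ (proj₂ (legFor r~y₂))

  R A₁ A₂ B₁ B₂ : V
  R = inj₁ r
  A₁ = legVertex ℓA 1
  A₂ = legVertex ℓA 2
  B₁ = legVertex ℓB 1
  B₂ = legVertex ℓB 2

  2≤k : 2 ≤ k
  2≤k = s≤s (s≤s z≤n)

  ℓA≢ℓB : ℓA ≢ ℓB
  ℓA≢ℓB eq = y₁≢y₂ (trans (sym end-ℓA) (trans (cong end eq) end-ℓB))

  R≡legVertex-0 : ∀ {ℓ} → start ℓ ≡ r → R ≡ legVertex ℓ 0
  R≡legVertex-0 {ℓ} s≡r = trans (cong inj₁ (sym s≡r)) (sym (legVertex-start ℓ))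

  marked-vertices : ∀ {x} → colour x ≡ marked → x ≡ R ⊎ x ≡ A₁ ⊎ x ≡ B₂
  marked-vertices {x} cx with placement x
  ... | atRoot x≡R = inj₁ x≡R
  ... | offTree cx' with () ← trans (sym cx') cx
  ... | onTree ℓ c@(e≢r , pe≡s) 0<j j≤k refl with code-marked e≢r (trans (sym (colour-towards-child ℓ c 0<j j≤k)) cx)
  ...   | pe≡r , inj₁ (e≡y₁ , refl) = inj₂ (inj₁ (cong (λ ℓ → legVertex ℓ 1) (leg-unique {ℓ} {ℓA} (trans (sym pe≡s) (trans pe≡r (sym start-ℓA))) (trans e≡y₁ (sym end-ℓA)))))
  ...   | pe≡r , inj₂ (e≡y₂ , refl) = inj₂ (inj₂ (cong (λ ℓ → legVertex ℓ 2) (leg-unique {ℓ} {ℓB} (trans (sym pe≡s) (trans pe≡r (sym start-ℓB))) (trans e≡y₂ (sym end-ℓB)))))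

  R≁B₂ : ¬ R ~ B₂
  R≁B₂ a with start-neighbours a
  ... | ℓ , s≡r , B₂≡ with () ← proj₂ (legVertex-cross-injective {ℓB} {ℓ} (trans start-ℓB (sym s≡r)) (s≤s z≤n) 2≤k (s≤s z≤n) (s≤s z≤n) B₂≡)

  A₁≁B₂ : ¬ A₁ ~ B₂
  A₁≁B₂ a with legVertex-neighbours ℓA (s≤s z≤n) 2≤k a
  ... | inj₁ B₂≡A₀ with () ← legVertex-injective ℓB 2≤k z≤n (trans B₂≡A₀ (trans (sym (R≡legVertex-0 {ℓA} start-ℓA)) (R≡legVertex-0 {ℓB} start-ℓB)))
  ... | inj₂ B₂≡A₂ = ℓA≢ℓB (sym (proj₁ (legVertex-cross-injective {ℓB} {ℓA} (trans start-ℓB (sym start-ℓA)) (s≤s z≤n) 2≤k (s≤s z≤n) 2≤k B₂≡A₂)))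

  A₂≁B₂ : ¬ A₂ ~ B₂
  A₂≁B₂ a with m≤n⇒m<n∨m≡n 2≤k
  ... | inj₂ 2≡k = originals-nonadjacent (subst₂ _~_ (at-end ℓA) (at-end ℓB) a)
    where
    at-end : ∀ ℓ → legVertex ℓ 2 ≡ inj₁ (end ℓ)
    at-end ℓ = trans (cong (legVertex ℓ) 2≡k) (legVertex-end ℓ)
  ... | inj₁ 2<k with legVertex-neighbours ℓA (s≤s z≤n) 2<k a
  ...   | inj₁ B₂≡A₁ with () ← proj₂ (legVertex-cross-injective {ℓB} {ℓA} (trans start-ℓB (sym start-ℓA)) (s≤s z≤n) 2≤k (s≤s z≤n) (s≤s z≤n) B₂≡A₁)
  ...   | inj₂ B₂≡A₃ = ℓA≢ℓB (sym (proj₁ (legVertex-cross-injective {ℓB} {ℓA} (trans start-ℓB (sym start-ℓA)) (s≤s z≤n) 2≤k (s≤s z≤n) 2<k B₂≡A₃)))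

  B₂-unmarked-neighbours : ∀ {z} → B₂ ~ z → colour z ≢ marked
  B₂-unmarked-neighbours {z} a cz with marked-vertices {z} cz
  ... | inj₁ refl = R≁B₂ (~-sym a)
  ... | inj₂ (inj₁ refl) = A₁≁B₂ (~-sym a)
  ... | inj₂ (inj₂ refl) = ~-irrefl a

  colour-R : colour R ≡ marked
  colour-R with r ≟ᶠ r
  ... | yes _ = refl
  ... | no r≢r = contradiction refl r≢r

  colour-A₁ : colour A₁ ≡ marked
  colour-A₁ = trans (colour-towards-child ℓA tree-leg (s≤s z≤n) (s≤s z≤n)) (trans (cong (λ y → code y 1) end-ℓA) (code-y₁ 1))
    where
    tree-leg : end ℓA isChildOf start ℓA
    tree-leg = subst (_≢ r) (sym end-ℓA) y₁≢r , trans (cong parent end-ℓA) (trans parent-y₁ (sym start-ℓA))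

  colour-B₂ : colour B₂ ≡ marked
  colour-B₂ = trans (colour-towards-child ℓB tree-leg (s≤s z≤n) 2≤k) (trans (cong (λ y → code y 2) end-ℓB) (code-y₂ 2))
    where
    tree-leg : end ℓB isChildOf start ℓB
    tree-leg = subst (_≢ r) (sym end-ℓB) y₂≢r , trans (cong parent end-ℓB) (trans parent-y₂ (sym start-ℓB))

  module _ (σ : V ↔ V) (aut : IsAutomorphism _~_ σ) (preserved : ∀ x → colour (Inverse.to σ x) ≡ colour x) where
    open Automorphism σ aut

    colour-from : ∀ x → colour (from x) ≡ colour x
    colour-from x = trans (sym (preserved (from x))) (cong colour (to-from x))

    R~A₁ : R ~ A₁
    R~A₁ = subst (λ p → inj₁ p ~ A₁) start-ℓA (start-adjacent ℓA)

    R~B₁ : R ~ B₁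
    R~B₁ = subst (λ p → inj₁ p ~ B₁) start-ℓB (start-adjacent ℓB)

    -- B₂ is the only marked vertex without a marked neighbour
    B₂-fixed : to B₂ ≡ B₂
    B₂-fixed with marked-vertices (trans (preserved B₂) colour-B₂)
    ... | inj₂ (inj₂ tB₂≡B₂) = tB₂≡B₂
    ... | inj₁ tB₂≡R = ⊥-elim (B₂-unmarked-neighbours (subst (_~ from A₁) (from-image tB₂≡R) (~-from R~A₁)) (trans (colour-from A₁) colour-A₁))
      where
      from-image : ∀ {x} → to B₂ ≡ x → from x ≡ B₂
      from-image refl = from-to B₂
    ... | inj₂ (inj₁ tB₂≡A₁) = ⊥-elim (B₂-unmarked-neighbours (subst (_~ from R) (from-image tB₂≡A₁) (~-from (~-sym R~A₁))) (trans (colour-from R) colour-R))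
      where
      from-image : ∀ {x} → to B₂ ≡ x → from x ≡ B₂
      from-image refl = from-to B₂

    root-fixed : to R ≡ R
    root-fixed with marked-vertices (trans (preserved R) colour-R)
    ... | inj₁ tR≡R = tR≡R
    ... | inj₂ (inj₂ tR≡B₂) with () ← legVertex-injective ℓB z≤n 2≤k (trans (sym (R≡legVertex-0 {ℓB} start-ℓB)) (to-injective (trans tR≡B₂ (sym B₂-fixed))))
    ... | inj₂ (inj₁ tR≡A₁) with legVertex-neighbours ℓA (s≤s z≤n) 2≤k (subst (_~ to B₁) tR≡A₁ (~-to R~B₁))
    ...   | inj₁ tB₁≡R = ⊥-elim (R≁B₂ (subst₂ _~_ (trans tB₁≡R (sym (R≡legVertex-0 {ℓA} start-ℓA))) B₂-fixed (~-to (legVertex-adjacent ℓB 2≤k))))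
    ...   | inj₂ tB₁≡A₂ = ⊥-elim (A₂≁B₂ (subst₂ _~_ tB₁≡A₂ B₂-fixed (~-to (legVertex-adjacent ℓB 2≤k))))

pow-step : ∀ K b → b ^ suc K + suc b ^ K ≤ suc b ^ suc K
pow-step K b = begin
  b * b ^ K + suc b ^ K      ≤⟨ +-monoˡ-≤ (suc b ^ K) (*-monoʳ-≤ b (^-monoˡ-≤ K (n≤1+n b))) ⟩
  b * suc b ^ K + suc b ^ K  ≡⟨ +-comm (b * suc b ^ K) (suc b ^ K) ⟩
  suc b * suc b ^ K          ∎
  where open ≤-Reasoning

-- b^(K+1) + Σ_{j=b+1}^{b+t} j^K ≤ (b+t)^(K+1), by telescoping pow-step
pow-sum-bound : ∀ K b t → b ^ suc K + sum (map (_^ K) (applyUpTo (λ i → suc (b + i)) t)) ≤ (b + t) ^ suc K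
pow-sum-bound K b zero rewrite +-identityʳ b | +-identityʳ (b ^ suc K) = ≤-refl
pow-sum-bound K b (suc t) = begin
  b ^ suc K + (suc (b + 0) ^ K + rest)  ≡⟨ cong (λ c → b ^ suc K + (suc c ^ K + rest)) (+-identityʳ b) ⟩
  b ^ suc K + (suc b ^ K + rest)        ≡⟨ +-assoc (b ^ suc K) (suc b ^ K) rest ⟨
  b ^ suc K + suc b ^ K + rest          ≤⟨ +-monoˡ-≤ rest (pow-step K b) ⟩
  suc b ^ suc K + rest                  ≡⟨ cong (λ xs → suc b ^ suc K + sum (map (_^ K) xs)) (applyUpTo-cong (λ i → cong suc (+-suc b i)) t) ⟩
  suc b ^ suc K + rest'                 ≤⟨ pow-sum-bound K (suc b) t ⟩
  (suc b + t) ^ suc K                   ≡⟨ cong (_^ suc K) (+-suc b t) ⟨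
  (b + suc t) ^ suc K                   ∎
  where
  open ≤-Reasoning
  rest rest' : ℕ
  rest = sum (map (_^ K) (applyUpTo (λ i → suc (b + suc i)) t))
  rest' = sum (map (_^ K) (applyUpTo (λ i → suc (suc b + i)) t))

BoundCond⇒≤pow : ∀ m s {Δ} → 2 ≤ s → BoundCond (suc (suc m)) Δ s → Δ ≤ s ^ suc (suc m)
BoundCond⇒≤pow m (suc zero) (s≤s ()) _
BoundCond⇒≤pow m (suc (suc t)) _ bound = ≤-trans bound (pow-sum-bound (suc m) 2 t)

DistNumberAtMost-mono : ∀ {V : Set} {_∼_ : V → V → Set} {s t} → s ≤ t → DistNumberAtMost _∼_ s → DistNumberAtMost _∼_ t
DistNumberAtMost-mono s≤t (d , d≤s , c , distinguishing) = d , ≤-trans d≤s s≤t , c , distinguishing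

large-degree-case : ∀ {n} (G : SimpleGraph n) m → Connected G → 3 ≤ maxDegree G →
                    ∀ s → maxDegree G ≤ suc (suc s) ^ suc (suc m) → DistNumberAtMost (SubAdj G (suc (suc m))) (suc (suc s))
large-degree-case G m connected 3≤Δ s Δ≤Sᵏ
  with Degrees.<maxDegree⇒<degree G 3≤Δ
... | r , 2<deg with Degrees.three-neighbours G 2<deg
...   | y₀ , y₁ , y₂ , r~y₀ , r~y₁ , r~y₂ , y₀≢y₁ , y₀≢y₂ , y₁≢y₂ =
  suc (suc s) , ≤-refl , colour , distinguishing separated
    (λ σ aut preserved → root-fixed σ aut preserved r~y₁ r~y₂ y₀≢y₁ y₀≢y₂ y₁≢y₂)
  where open LargeDegree G m connected r y₀ r~y₀ s Δ≤Sᵏ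

small-degree-case : ∀ {n} (G : SimpleGraph (suc (suc (suc n)))) m → Connected G → maxDegree G ≤ 2 →
                    DistNumberAtMost (SubAdj G (suc (suc m))) 2
small-degree-case G m connected Δ≤2
  with Degrees.<maxDegree⇒<degree G (connected⇒2≤maxDegree G connected)
... | r , 1<deg with Degrees.two-neighbours G 1<deg
...   | y₁ , y₂ , r~y₁ , r~y₂ , y₁≢y₂ = 2 , ≤-refl , colour , distinguishing separated root-fixed
  where open SmallDegree G m connected r y₁ y₂ r~y₁ r~y₂ y₁≢y₂ Δ≤2

theorem3p8 : (n : ℕ) (G : SimpleGraph n) → 3 ≤ n → Connected G →
    (k : ℕ) → 2 ≤ k → (s : ℕ) → IsMinBound k (maxDegree G) s →
    DistNumberAtMost (SubAdj G k) s
theorem3p8 _ G (s≤s (s≤s (s≤s _))) connected (suc (suc m)) (s≤s (s≤s _)) s@(suc (suc s')) (2≤s , bound , _)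
  with 3 ≤? maxDegree G
... | yes 3≤Δ = large-degree-case G m connected 3≤Δ s' (BoundCond⇒≤pow m s 2≤s bound)
... | no 3≰Δ = DistNumberAtMost-mono 2≤s (small-degree-case G m connected (s≤s⁻¹ (≰⇒> 3≰Δ)))
theorem3p8 _ _ (s≤s (s≤s (s≤s _))) _ (suc (suc _)) (s≤s (s≤s _)) (suc zero) (s≤s () , _)
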